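{- Consider the ring of size $n\geq 3$ with any starting node, and let $k\geq 2$. For every exploration algorithm $A$ of class $\mathcal{A}_k$ there exists either an algorithm of class $\mathcal{A}_0$ or an $i$-step algorithm of class $\mathcal{A}_1$ with $i\leq 2$, whose overhead is smaller than or equal to the overhead of $A$.
   Context: Exploration model: a graph is simple, connected, undirected, with distinct node labels and ports $1,\dots,d$ at each node of degree $d$. A mobile agent starts at node $v$ with a complete labeled map. A fault configuration is a set $F$ of faulty edges, unknown to the agent; faulty edges cannot be traversed, and on first visiting a node the agent learns which incident ports are faulty (others are free). $C$ is the connected component of $v$ in the graph with faulty edges removed; exploration is finished when the last node of $C$ is visited. The cost $\mathcal{C}(A,F)$ is the number of edge traversals; $opt(F)$ is the minimum number of traversals needed to visit all nodes of $C$ from $v$ knowing $F$; the overhead is $\mathcal{O}_A=\max_F \mathcal{C}(A,F)/opt(F)$ (ratio $1$ when $C=\{v\}$). The ring of size $n$ has nodes $v_1,\dots,v_n$ and edges $\{v_i,v_{i+1}\}$, $\{v_n,v_1\}$; port $\ell$ leads to the predecessor and port $r$ to the successor of each node. Class $\mathcal{A}_0$: fix a direction $d$; the agent repeatedly takes port $d$ until port $d$ at the current node is faulty or all $n$ nodes are visited, then, if needed, repeatedly takes the opposite port until that port is faulty or all nodes are visited. Class $\mathcal{A}_k$ ($k\ge 1$): fix a direction $d$ and positive integers $z_1,\dots,z_k$ with $z_1<z_3<z_5<\cdots$ and $z_2<z_4<\cdots$. Provided no fault is met, the agent goes in direction $d$ to the node at distance $z_1$ from $v$, then reverses and goes to the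 node at distance $z_2$ from $v$ on the other side, then reverses and goes to the node at distance $z_3$ on the first side, and so on, alternating, performing $k$ returns (direction changes) in total; then it repeatedly moves in the current direction until it meets a faulty port or all nodes are visited, and if a fault is met it reverses and moves until a faulty port is met or all nodes are visited. If during the initial alternating phase a faulty port is met in the current direction, the agent reverses and moves in the opposite direction until a faulty port is met or all nodes are visited. The agent stops as soon as all nodes of $C$ are visited. An algorithm of class $\mathcal{A}_1$ with $z_1=i$ is called an $i$-step algorithm of class $\mathcal{A}_1$. -}

module Defs where

open import Data.Bool using (Bool; true; false; _∧_; _∨_; not; if_then_else_)
open import Data.Nat using (ℕ; zero; suc; _+_; _*_; _<_; _≤_)
open import Data.Nat.DivMod using (_mod_)
open import Data.Fin using (Fin; toℕ; _≟_)
open import Data.Vec using (Vec; lookup; []; _∷_)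
open import Data.List using (List; []; _∷_; length; upTo; allFin; map; foldr; _++_)
open import Data.Bool.ListAction using (any; all)
open import Relation.Binary.PropositionalEquality using (_≡_)
open import Data.List.Relation.Unary.All using (All)
open import Data.Maybe using (Maybe; just; nothing)
open import Data.Product using (_×_; _,_)
open import Data.Unit using (⊤)
open import Data.Integer using (+_)
open import Data.Rational using (ℚ; _/_; 0ℚ; 1ℚ; _⊔_)
open import Relation.Nullary.Decidable using (⌊_⌋)

-- The ring of size n: nodes v_1..v_n are Fin n (v_{i+1} ↦ i).
-- Port `right` (= r) leads to the successor, `left` (= ℓ) to the predecessor.

data Dir : Set where
  left right : Dir

opp : Dir → Dir
opp left  = right
opp right = left

sucMod : ∀ {n} → Fin n → Fin n
sucMod {suc m} u = suc (toℕ u) mod suc m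

predMod : ∀ {n} → Fin n → Fin n
predMod {suc m} u = (toℕ u + m) mod suc m

move : ∀ {n} → Fin n → Dir → Fin n
move u right = sucMod u
move u left  = predMod u

-- A fault configuration: edge j (joining node j and node j+1 mod n) is
-- faulty iff the j-th entry is true.
Faults : ℕ → Set
Faults n = Vec Bool n

faultyPort : ∀ {n} → Faults n → Fin n → Dir → Bool
faultyPort F u right = lookup F u
faultyPort F u left  = lookup F (predMod u)

iter : ∀ {A : Set} → ℕ → (A → A) → A → A
iter zero    f x = x
iter (suc j) f x = iter j f (f x)

freeRun : ∀ {n} → Faults n → Fin n → Dir → ℕ → Bool
freeRun F u δ zero    = true
freeRun F u δ (suc j) = not (faultyPort F u δ) ∧ freeRun F (move u δ) δ j

reachDir : ∀ {n} → Faults n → Fin n → Fin n → Dir → Bool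
reachDir {n} F v w δ =
  any (λ j → ⌊ iter j (λ x → move x δ) v ≟ w ⌋ ∧ freeRun F v δ j) (upTo n)

inC : ∀ {n} → Faults n → Fin n → Fin n → Bool
inC F v w = reachDir F v w left ∨ reachDir F v w right

mark : ∀ {n} → (Fin n → Bool) → Fin n → (Fin n → Bool)
mark vis u w = vis w ∨ ⌊ w ≟ u ⌋

covered : ∀ {n} → Faults n → Fin n → (Fin n → Bool) → Bool
covered {n} F v vis = all (λ w → not (inC F v w) ∨ vis w) (allFin n)

walkCovers : ∀ {n} → Faults n → Fin n → Fin n → (Fin n → Bool) → List Dir → Bool
walkCovers F v u vis []       = covered F v vis
walkCovers F v u vis (δ ∷ ds) =
  not (faultyPort F u δ) ∧ walkCovers F v (move u δ) (mark vis (move u δ)) ds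

dirLists : ℕ → List (List Dir)
dirLists zero    = [] ∷ []
dirLists (suc m) = map (left ∷_) (dirLists m) ++ map (right ∷_) (dirLists m)

coverableIn : ∀ {n} → Faults n → Fin n → ℕ → Bool
coverableIn F v m = any (walkCovers F v v (mark (λ _ → false) v)) (dirLists m)

-- least m ≤ b with p m (returns b if there is none)
least : (ℕ → Bool) → ℕ → ℕ
least p zero    = zero
least p (suc b) = if p zero then zero else suc (least (λ m → p (suc m)) b)

-- a covering walk of length ≤ 2n always exists, so this is the true minimum
opt : ∀ {n} → Faults n → Fin n → ℕ
opt {n} F v = least (coverableIn F v) (2 * n)

-- Algorithms of classes A_k: a direction d and turning distances z_1..z_k.

record Alg : Set where
  constructor alg
  field
    dir : Dir
    zs  : List ℕ

open Alg public

Incr2 : List ℕ → Set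
Incr2 (a ∷ b ∷ c ∷ rest) = a < c × Incr2 (b ∷ c ∷ rest)
Incr2 _                  = ⊤

InClass : ℕ → Alg → Set
InClass k A = length (zs A) ≡ k × All (λ z → 1 ≤ z) (zs A) × Incr2 (zs A)

IsStepAlg : ℕ → Alg → Set
IsStepAlg i A = InClass 1 A × zs A ≡ (i ∷ [])

data Mode : Set where
  legs  : Dir → ℕ → List ℕ → Mode  -- alternating phase: direction, steps left in current leg, later legs
  free1 : Dir → Mode
  free2 : Dir → Mode

nextFree2 : ∀ {n} → Faults n → Dir → Fin n → Maybe (Dir × Mode)
nextFree2 F δ u = if faultyPort F u δ then nothing else just (δ , free2 δ)

nextFree1 : ∀ {n} → Faults n → Dir → Fin n → Maybe (Dir × Mode)
nextFree1 F δ u = if faultyPort F u δ then nextFree2 F (opp δ) u else just (δ , free1 δ)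

nextLegs : ∀ {n} → Faults n → Dir → ℕ → List ℕ → Fin n → Maybe (Dir × Mode)
nextLegs F δ (suc s) rest u =
  if faultyPort F u δ then nextFree2 F (opp δ) u else just (δ , legs δ s rest)
nextLegs F δ zero []         u = nextFree1 F (opp δ) u
nextLegs F δ zero (l ∷ rest) u = nextLegs F (opp δ) l rest u

next : ∀ {n} → Faults n → Mode → Fin n → Maybe (Dir × Mode)
next F (legs δ s rest) u = nextLegs F δ s rest u
next F (free1 δ)       u = nextFree1 F δ u
next F (free2 δ)       u = nextFree2 F δ u

run : ∀ {n} → ℕ → Faults n → Fin n → Mode → Fin n → (Fin n → Bool) → ℕ
runStep : ∀ {n} → ℕ → Faults n → Fin n → Maybe (Dir × Mode) → Fin n → (Fin n → Bool) → ℕ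

run fuel F v m u vis =
  if covered F v vis then zero else runStep fuel F v (next F m u) u vis

runStep zero     F v _               u vis = zero
runStep (suc f)  F v nothing         u vis = zero
runStep (suc f)  F v (just (δ , m')) u vis =
  suc (run f F v m' (move u δ) (mark vis (move u δ)))

-- leg lengths: z_1, z_1+z_2, z_2+z_3, ...
pairSums : ℕ → List ℕ → List ℕ
pairSums p []       = []
pairSums p (z ∷ zs) = (p + z) ∷ pairSums z zs

initMode : Dir → List ℕ → Mode
initMode d []       = free1 d
initMode d (z ∷ zs) = legs d z (pairSums z zs)

-- C(A,F) for starting node v; the fuel bound exceeds the (k+2)(n-1)
-- traversals after which any such agent has visited all of C.
cost : ∀ {n} → Alg → Faults n → Fin n → ℕ
cost {n} A F v =
  run (2 * n * (length (zs A) + 3)) F v (initMode (dir A) (zs A)) v (mark (λ _ → false) v)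

ratio : ℕ → ℕ → ℚ
ratio c zero    = 1ℚ
ratio c (suc o) = (+ c) / suc o

allFaults : (n : ℕ) → List (Faults n)
allFaults zero    = [] ∷ []
allFaults (suc n) = map (true ∷_) (allFaults n) ++ map (false ∷_) (allFaults n)

overhead : ∀ {n} → Fin n → Alg → ℚ
overhead {n} v A = foldr (λ F acc → ratio (cost A F v) (opt F v) ⊔ acc) 0ℚ (allFaults n)

module Submission where

-- Write n = m + 1 and T = (2n - 3)/n.  The theorem is the sandwich
--   overhead (A_0 going right)  ≤  T  ≤  overhead A        (A ∈ A_k, k ≥ 2).
--  * Upper bound.  Fix faults F; let a, b be the distances from v to the first
--    fault on the right and on the left.  The A_0 agent pays m if the right side
--    is fault-free, a if b = 0, and 2a + b otherwise, while every covering walk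
--    of the segment [-b, a] pays at least min (a + 2b, 2a + b) (a walk covering
--    an interval around its start visits one end first and then crosses to the
--    other one).  So each ratio is ≤ 1 or ≤ (2a + b)/(a + 2b) ≤ T.
--  * Lower bound.  Let z₁, z₂ ≥ 1 be the first two turning distances of A.
--    If z₁ ≤ n - 3, faults just behind v and at distance z₁ + 1 ahead make the
--    agent pay 3z₁ + 1 against opt ≤ z₁ + 1; otherwise one fault at distance
--    n - 2 ahead makes it pay 2n - 3 against opt ≤ n.  Both ratios are ≥ T.

open import Defs
open import Data.Bool using (Bool; true; false; _∧_; _∨_; not)
open import Data.Bool.Properties using (∨-zeroʳ; ∨-identityʳ; ∧-identityʳ)
open import Data.Bool.ListAction using (any; all)
open import Data.Empty using (⊥; ⊥-elim)
open import Data.Fin using (Fin; toℕ; _≟_)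
open import Data.Fin.Properties using (toℕ-injective; toℕ-fromℕ<; toℕ<n)
import Data.Integer as ℤ
import Data.Integer.Properties as ℤ
open import Data.List using (List; []; _∷_; length; upTo; allFin; map; foldr; _++_; replicate)
open import Data.List.Properties using (length-replicate; ++-identityʳ)
open import Data.List.Membership.Propositional using (_∈_)
open import Data.List.Membership.Propositional.Properties using (∈-allFin; ∈-upTo⁺; ∈-upTo⁻; ∈-map⁺; ∈-++⁺ˡ; ∈-++⁺ʳ)
open import Data.List.Relation.Unary.All using (All; []; _∷_)
open import Data.List.Relation.Unary.Any using (here; there)
open import Data.Maybe using (just)
open import Data.Nat using (ℕ; zero; suc; _+_; _*_; _∸_; _≤_; _<_; z≤n; s≤s; _%_)
open import Data.Nat.DivMod using (%-distribˡ-+; m%n%n≡m%n; m<n⇒m%n≡m; [m+n]%n≡m%n; m%n<n; m≤n⇒[n∸m]%m≡n%m)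
open import Data.Nat.Properties hiding (_≟_)
open import Data.Nat.Tactic.RingSolver using (solve-∀)
open import Data.Product using (Σ; _×_; _,_; proj₁; proj₂)
open import Data.Rational using (ℚ; _/_; 0ℚ; _⊔_) renaming (_≤_ to _≤ℚ_)
import Data.Rational.Properties as Q
open import Data.Rational.Unnormalised using (mkℚᵘ; *≤*)
import Data.Rational.Unnormalised.Properties as ℚᵘ
open import Data.Sum using (_⊎_; inj₁; inj₂; [_,_]′)
open import Data.Unit using (tt)
open import Data.Vec using ([]; _∷_; lookup; tabulate)
open import Data.Vec.Properties using (lookup∘tabulate)
open import Relation.Nullary using (Dec; yes; no; ¬_)
open import Relation.Nullary.Decidable using (⌊_⌋)
open import Relation.Binary.PropositionalEquality

∨-true : ∀ {a b} → a ∨ b ≡ true → a ≡ true ⊎ b ≡ true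
∨-true {true}  _ = inj₁ refl
∨-true {false} e = inj₂ e

∧-true : ∀ {a b} → a ∧ b ≡ true → a ≡ true × b ≡ true
∧-true {true} {true} _ = refl , refl

not-true : ∀ {b} → not b ≡ true → b ≡ false
not-true {false} _ = refl

false≡true-elim : ∀ {A : Set} → false ≡ true → A
false≡true-elim ()

⌊⌋-true : ∀ {A : Set} (d : Dec A) → A → ⌊ d ⌋ ≡ true
⌊⌋-true (yes _) _ = refl
⌊⌋-true (no ¬a) a = ⊥-elim (¬a a)

⌊⌋-false : ∀ {A : Set} (d : Dec A) → ¬ A → ⌊ d ⌋ ≡ false
⌊⌋-false (yes a) ¬a = ⊥-elim (¬a a)
⌊⌋-false (no _)  _  = refl

⌊⌋-sound : ∀ {A : Set} (d : Dec A) → ⌊ d ⌋ ≡ true → A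
⌊⌋-sound (yes a) _ = a

all-elim : ∀ {A : Set} (f : A → Bool) (xs : List A) {x} → all f xs ≡ true → x ∈ xs → f x ≡ true
all-elim f (y ∷ xs) e (here refl) = proj₁ (∧-true e)
all-elim f (y ∷ xs) e (there mem) = all-elim f xs (proj₂ (∧-true {f y} e)) mem

all-intro : ∀ {A : Set} (f : A → Bool) (xs : List A) → (∀ x → f x ≡ true) → all f xs ≡ true
all-intro f []       h = refl
all-intro f (y ∷ xs) h rewrite h y = all-intro f xs h

any-elim : ∀ {A : Set} (f : A → Bool) (xs : List A) → any f xs ≡ true → Σ A (λ x → x ∈ xs × f x ≡ true)
any-elim f (y ∷ xs) e with f y in eq
... | true = y , here refl , eq
... | false with any-elim f xs e
... | x , mem , fx = x , there mem , fx

any-intro : ∀ {A : Set} (f : A → Bool) (xs : List A) {x} → x ∈ xs → f x ≡ true → any f xs ≡ true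
any-intro f (y ∷ xs) (here refl) fx rewrite fx = refl
any-intro f (y ∷ xs) (there mem) fx with f y
... | true  = refl
... | false = any-intro f xs mem fx

any-++ : ∀ {A : Set} (f : A → Bool) (xs ys : List A) → any f (xs ++ ys) ≡ any f xs ∨ any f ys
any-++ f []       ys = refl
any-++ f (x ∷ xs) ys with f x
... | true  = refl
... | false = any-++ f xs ys

any-map : ∀ {A B : Set} (f : B → Bool) (g : A → B) (xs : List A) → any f (map g xs) ≡ any (λ x → f (g x)) xs
any-map f g []       = refl
any-map f g (x ∷ xs) = cong (f (g x) ∨_) (any-map f g xs)

dirLists-elim : ∀ m (f : List Dir → Bool) → any f (dirLists m) ≡ true →
  Σ (List Dir) (λ ds → length ds ≡ m × f ds ≡ true)
dirLists-elim zero    f e = [] , refl , trans (sym (∨-identityʳ (f []))) e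
dirLists-elim (suc m) f e
  with ∨-true (trans (sym (any-++ f (map (left ∷_) (dirLists m)) (map (right ∷_) (dirLists m)))) e)
... | inj₁ e₁ with dirLists-elim m (λ ds → f (left ∷ ds)) (trans (sym (any-map f (left ∷_) (dirLists m))) e₁)
...   | ds , len , fds = left ∷ ds , cong suc len , fds
dirLists-elim (suc m) f e | inj₂ e₂
  with dirLists-elim m (λ ds → f (right ∷ ds)) (trans (sym (any-map f (right ∷_) (dirLists m))) e₂)
...   | ds , len , fds = right ∷ ds , cong suc len , fds

dirLists-intro : ∀ (f : List Dir → Bool) ds → f ds ≡ true → any f (dirLists (length ds)) ≡ true
dirLists-intro f []       e rewrite e = refl
dirLists-intro f (δ ∷ ds) e = trans (any-++ f (map (left ∷_) Ds) (map (right ∷_) Ds)) (choose δ this-half)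
  where
    Ds : List (List Dir)
    Ds = dirLists (length ds)
    this-half : any f (map (δ ∷_) Ds) ≡ true
    this-half = trans (any-map f (δ ∷_) Ds) (dirLists-intro (λ x → f (δ ∷ x)) ds e)
    choose : ∀ δ' → any f (map (δ' ∷_) Ds) ≡ true → any f (map (left ∷_) Ds) ∨ any f (map (right ∷_) Ds) ≡ true
    choose left  h = cong (_∨ any f (map (right ∷_) Ds)) h
    choose right h = trans (cong (any f (map (left ∷_) Ds) ∨_) h) (∨-zeroʳ _)

allFaults-complete : ∀ n (F : Faults n) → F ∈ allFaults n
allFaults-complete zero    []      = here refl
allFaults-complete (suc n) (true ∷ F)  = ∈-++⁺ˡ (∈-map⁺ (true ∷_) (allFaults-complete n F))
allFaults-complete (suc n) (false ∷ F) =
  ∈-++⁺ʳ (map (true ∷_) (allFaults n)) (∈-map⁺ (false ∷_) (allFaults-complete n F))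

least-≤ : ∀ (p : ℕ → Bool) b t → p t ≡ true → t ≤ b → least p b ≤ t
least-≤ p zero    t       e le = z≤n
least-≤ p (suc b) zero    e le rewrite e = z≤n
least-≤ p (suc b) (suc t) e (s≤s le) with p 0
... | true  = z≤n
... | false = s≤s (least-≤ (λ x → p (suc x)) b t e le)

≤-least : ∀ (p : ℕ → Bool) b t → (∀ j → j < t → p j ≡ false) → t ≤ b → t ≤ least p b
≤-least p b       zero    h le = z≤n
≤-least p (suc b) (suc t) h (s≤s le) rewrite h 0 (s≤s z≤n) =
  s≤s (≤-least (λ x → p (suc x)) b t (λ j lt → h (suc j) (s≤s lt)) le)

FirstBelow : (ℕ → Bool) → ℕ → Set
FirstBelow P b = Σ ℕ (λ a → a < b × P a ≡ true × (∀ i → i < a → P i ≡ false))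

first-or-none : (P : ℕ → Bool) (b : ℕ) → FirstBelow P b ⊎ (∀ i → i < b → P i ≡ false)
first-or-none P zero = inj₂ (λ i ())
first-or-none P (suc b) with first-or-none P b
... | inj₁ (a , lt , pa , before) = inj₁ (a , ≤-trans lt (n≤1+n b) , pa , before)
... | inj₂ none with P b in eq
...   | true  = inj₁ (b , ≤-refl , eq , none)
...   | false = inj₂ extend
  where
    extend : ∀ i → i < suc b → P i ≡ false
    extend i (s≤s le) with m≤n⇒m<n∨m≡n le
    ... | inj₁ lt   = none i lt
    ... | inj₂ refl = eq

fraction-≤ : ∀ c o a b → c * suc b ≤ a * suc o → (ℤ.+ c) / suc o ≤ℚ (ℤ.+ a) / suc b
fraction-≤ c o a b le = Q.toℚᵘ-cancel-≤
  (ℚᵘ.≤-respˡ-≃ (ℚᵘ.≃-sym (Q.toℚᵘ-fromℚᵘ (mkℚᵘ (ℤ.+ c) o)))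
    (ℚᵘ.≤-respʳ-≃ (ℚᵘ.≃-sym (Q.toℚᵘ-fromℚᵘ (mkℚᵘ (ℤ.+ a) b)))
      (*≤* (subst₂ ℤ._≤_ (ℤ.pos-* c (suc b)) (ℤ.pos-* a (suc o)) (ℤ.+≤+ le)))))

max-≤ : ∀ {A : Set} (r : A → ℚ) (t : ℚ) (xs : List A) → (∀ x → r x ≤ℚ t) → 0ℚ ≤ℚ t →
  foldr (λ x acc → r x ⊔ acc) 0ℚ xs ≤ℚ t
max-≤ r t []       h z = z
max-≤ r t (x ∷ xs) h z = Q.⊔-lub (h x) (max-≤ r t xs h z)

≤-max : ∀ {A : Set} (r : A → ℚ) (xs : List A) {x} → x ∈ xs → r x ≤ℚ foldr (λ x acc → r x ⊔ acc) 0ℚ xs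
≤-max r (y ∷ xs) (here refl) = Q.p≤p⊔q _ _
≤-max r (y ∷ xs) (there mem) = Q.≤-trans (≤-max r xs mem) (Q.p≤q⊔p (r y) _)

iter-suc : ∀ {A : Set} j (f : A → A) x → iter (suc j) f x ≡ f (iter j f x)
iter-suc zero    f x = refl
iter-suc (suc j) f x = iter-suc j f (f x)

iter-+ : ∀ {A : Set} i j (f : A → A) x → iter (i + j) f x ≡ iter j f (iter i f x)
iter-+ zero    j f x = refl
iter-+ (suc i) j f x = iter-+ i j f (f x)

opp-involutive : ∀ δ → opp (opp δ) ≡ δ
opp-involutive left  = refl
opp-involutive right = refl

same-or-opp : ∀ δ d → δ ≡ d ⊎ δ ≡ opp d
same-or-opp left  left  = inj₁ refl
same-or-opp left  right = inj₂ refl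
same-or-opp right left  = inj₂ refl
same-or-opp right right = inj₁ refl

∸-suc : ∀ z i → i < z → z ∸ i ≡ suc (z ∸ suc i)
∸-suc (suc z) i (s≤s le) = +-∸-assoc 1 le

module Ring (m : ℕ) where
  n : ℕ
  n = suc m

  mod-addˡ : ∀ a b → ((a % n) + b) % n ≡ (a + b) % n
  mod-addˡ a b = begin
      ((a % n) + b) % n           ≡⟨ %-distribˡ-+ (a % n) b n ⟩
      ((a % n % n) + (b % n)) % n ≡⟨ cong (λ t → (t + (b % n)) % n) (m%n%n≡m%n a n) ⟩
      ((a % n) + (b % n)) % n     ≡⟨ sym (%-distribˡ-+ a b n) ⟩
      (a + b) % n                 ∎
    where open ≡-Reasoning

  toℕ-sucMod : ∀ u → toℕ (sucMod {n} u) ≡ suc (toℕ u) % n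
  toℕ-sucMod u = toℕ-fromℕ< _

  toℕ-predMod : ∀ u → toℕ (predMod {n} u) ≡ (toℕ u + m) % n
  toℕ-predMod u = toℕ-fromℕ< _

  toℕ-mod : ∀ (u : Fin n) → toℕ u % n ≡ toℕ u
  toℕ-mod u = m<n⇒m%n≡m (toℕ<n u)

  predMod-sucMod : ∀ (u : Fin n) → predMod (sucMod u) ≡ u
  predMod-sucMod u = toℕ-injective (begin
      toℕ (predMod (sucMod u))       ≡⟨ toℕ-predMod (sucMod u) ⟩
      (toℕ (sucMod u) + m) % n       ≡⟨ cong (λ t → (t + m) % n) (toℕ-sucMod u) ⟩
      (suc (toℕ u) % n + m) % n      ≡⟨ mod-addˡ (suc (toℕ u)) m ⟩
      (suc (toℕ u) + m) % n          ≡⟨ cong (_% n) (sym (+-suc (toℕ u) m)) ⟩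
      (toℕ u + n) % n                ≡⟨ [m+n]%n≡m%n (toℕ u) n ⟩
      toℕ u % n                      ≡⟨ toℕ-mod u ⟩
      toℕ u                          ∎)
    where open ≡-Reasoning

  sucMod-predMod : ∀ (u : Fin n) → sucMod (predMod u) ≡ u
  sucMod-predMod u = toℕ-injective (begin
      toℕ (sucMod (predMod u))       ≡⟨ toℕ-sucMod (predMod u) ⟩
      suc (toℕ (predMod u)) % n      ≡⟨ cong (λ t → suc t % n) (toℕ-predMod u) ⟩
      (1 + (toℕ u + m) % n) % n      ≡⟨ cong (_% n) (+-comm 1 ((toℕ u + m) % n)) ⟩
      ((toℕ u + m) % n + 1) % n      ≡⟨ mod-addˡ (toℕ u + m) 1 ⟩
      (toℕ u + m + 1) % n            ≡⟨ cong (_% n) (trans (+-assoc (toℕ u) m 1) (cong (toℕ u +_) (+-comm m 1))) ⟩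
      (toℕ u + n) % n                ≡⟨ [m+n]%n≡m%n (toℕ u) n ⟩
      toℕ u % n                      ≡⟨ toℕ-mod u ⟩
      toℕ u                          ∎)
    where open ≡-Reasoning

  step : Dir → Fin n → Fin n
  step δ x = move x δ

  move-opp : ∀ δ (u : Fin n) → move (move u δ) (opp δ) ≡ u
  move-opp right u = predMod-sucMod u
  move-opp left  u = sucMod-predMod u

  toℕ-iter-sucMod : ∀ j u → toℕ (iter j (step right) u) ≡ (toℕ u + j) % n
  toℕ-iter-sucMod zero    u = trans (sym (toℕ-mod u)) (cong (_% n) (sym (+-identityʳ (toℕ u))))
  toℕ-iter-sucMod (suc j) u = begin
      toℕ (iter j (step right) (sucMod u)) ≡⟨ toℕ-iter-sucMod j (sucMod u) ⟩
      (toℕ (sucMod u) + j) % n             ≡⟨ cong (λ t → (t + j) % n) (toℕ-sucMod u) ⟩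
      (suc (toℕ u) % n + j) % n            ≡⟨ mod-addˡ (suc (toℕ u)) j ⟩
      (suc (toℕ u) + j) % n                ≡⟨ cong (_% n) (sym (+-suc (toℕ u) j)) ⟩
      (toℕ u + suc j) % n                  ∎
    where open ≡-Reasoning

  mod-shift-zero : ∀ x d → (x + d) % n ≡ x % n → d < n → d ≡ 0
  mod-shift-zero x d eq d<n with (x % n) + d <? n
  ... | yes lt = +-cancelˡ-≡ (x % n) d 0 (begin
          x % n + d         ≡⟨ sym (m<n⇒m%n≡m lt) ⟩
          (x % n + d) % n   ≡⟨ mod-addˡ x d ⟩
          (x + d) % n       ≡⟨ eq ⟩
          x % n             ≡⟨ sym (+-identityʳ _) ⟩
          x % n + 0         ∎)
    where open ≡-Reasoning
  ... | no nlt = ⊥-elim (<-irrefl d≡n d<n)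
    where
      open ≡-Reasoning
      r : ℕ
      r = x % n
      n≤r+d : n ≤ r + d
      n≤r+d = ≮⇒≥ nlt
      wrapped≤r : r + d ∸ n ≤ r
      wrapped≤r = ≤-trans (∸-monoˡ-≤ n (+-monoʳ-≤ r (<⇒≤ d<n))) (≤-reflexive (m+n∸n≡m r n))
      wrapped≡r : r + d ∸ n ≡ r
      wrapped≡r = begin
          r + d ∸ n          ≡⟨ sym (m<n⇒m%n≡m (≤-<-trans wrapped≤r (m%n<n x n))) ⟩
          (r + d ∸ n) % n    ≡⟨ m≤n⇒[n∸m]%m≡n%m n≤r+d ⟩
          (r + d) % n        ≡⟨ mod-addˡ x d ⟩
          (x + d) % n        ≡⟨ eq ⟩
          r                  ∎
      d≡n : d ≡ n
      d≡n = +-cancelˡ-≡ r d n (begin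
          r + d              ≡⟨ sym (m∸n+n≡m n≤r+d) ⟩
          (r + d ∸ n) + n    ≡⟨ cong (_+ n) wrapped≡r ⟩
          r + n              ∎)

  iter-predMod-cancel : ∀ d u → iter d (step right) (iter d (step left) u) ≡ u
  iter-predMod-cancel zero    u = refl
  iter-predMod-cancel (suc d) u = begin
      iter d (step right) (sucMod (iter (suc d) (step left) u))
        ≡⟨ cong (λ t → iter d (step right) (sucMod t)) (iter-suc d (step left) u) ⟩
      iter d (step right) (sucMod (predMod (iter d (step left) u)))
        ≡⟨ cong (iter d (step right)) (sucMod-predMod _) ⟩
      iter d (step right) (iter d (step left) u)
        ≡⟨ iter-predMod-cancel d u ⟩
      u ∎
    where open ≡-Reasoning

  iter-return : ∀ δ d u → iter d (step δ) u ≡ u → d < n → d ≡ 0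
  iter-return right d u eq d<n = mod-shift-zero (toℕ u) d
    (trans (sym (toℕ-iter-sucMod d u)) (trans (cong toℕ eq) (sym (toℕ-mod u)))) d<n
  iter-return left  d u eq d<n = iter-return right d (iter d (step left) u)
    (trans (iter-predMod-cancel d u) (sym eq)) d<n

  iter-period : ∀ δ u → iter n (step δ) u ≡ u
  iter-period right u = toℕ-injective
    (trans (toℕ-iter-sucMod n u) (trans ([m+n]%n≡m%n (toℕ u) n) (toℕ-mod u)))
  iter-period left  u = begin
      iter n (step left) u                       ≡⟨ sym (iter-period right _) ⟩
      iter n (step right) (iter n (step left) u) ≡⟨ iter-predMod-cancel n u ⟩
      u                                          ∎
    where open ≡-Reasoning

  module From (v : Fin n) where
    node : Dir → ℕ → Fin n
    node δ j = iter j (step δ) v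

    node-suc : ∀ δ j → node δ (suc j) ≡ move (node δ j) δ
    node-suc δ j = iter-suc j (step δ) v

    node-back : ∀ δ j → move (node δ (suc j)) (opp δ) ≡ node δ j
    node-back δ j = trans (cong (λ t → move t (opp δ)) (node-suc δ j)) (move-opp δ (node δ j))

    node-period : ∀ δ j → node δ (n + j) ≡ node δ j
    node-period δ j = trans (iter-+ n j (step δ) v) (cong (iter j (step δ)) (iter-period δ v))

    node-return : ∀ δ i d → node δ (i + d) ≡ node δ i → d < n → d ≡ 0
    node-return δ i d eq d<n = iter-return δ d (node δ i) (trans (sym (iter-+ i d (step δ) v)) eq) d<n

    node-injective : ∀ δ i j → i < n → j < n → node δ i ≡ node δ j → i ≡ j
    node-injective δ i j i<n j<n e with ≤-total i j
    ... | inj₁ i≤j with m≤n⇒∃[o]m+o≡n i≤j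
    ...   | k , refl = sym (trans (cong (i +_) (node-return δ i k (sym e) (≤-<-trans (m≤n+m k i) j<n))) (+-identityʳ i))
    node-injective δ i j i<n j<n e | inj₂ j≤i with m≤n⇒∃[o]m+o≡n j≤i
    ...   | k , refl = trans (cong (j +_) (node-return δ j k e (≤-<-trans (m≤n+m k j) i<n))) (+-identityʳ j)

    node-behind : ∀ δ → move v (opp δ) ≡ node δ m
    node-behind δ = begin
        move v (opp δ)               ≡⟨ cong (λ t → move t (opp δ)) (sym (iter-period δ v)) ⟩
        move (node δ (suc m)) (opp δ) ≡⟨ node-back δ m ⟩
        node δ m                     ∎
      where open ≡-Reasoning

module Edges (m : ℕ) (v : Fin (suc m)) (d : Dir) where
  open Ring m
  open From v

  edgeIndex : Fin n → Dir → Fin n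
  edgeIndex u right = u
  edgeIndex u left  = predMod u

  faultyPort-edge : ∀ (F : Faults n) u δ → faultyPort F u δ ≡ lookup F (edgeIndex u δ)
  faultyPort-edge F u right = refl
  faultyPort-edge F u left  = refl

  edgeIndex-opp : ∀ u δ → edgeIndex (move u δ) (opp δ) ≡ edgeIndex u δ
  edgeIndex-opp u right = predMod-sucMod u
  edgeIndex-opp u left  = refl

  edgeIndex-injective : ∀ u w δ → edgeIndex u δ ≡ edgeIndex w δ → u ≡ w
  edgeIndex-injective u w right e = e
  edgeIndex-injective u w left  e = trans (sym (sucMod-predMod u)) (trans (cong sucMod e) (sucMod-predMod w))

  edge : ℕ → Fin n
  edge j = edgeIndex (node d j) d

  edge-injective : ∀ i j → i < n → j < n → edge i ≡ edge j → i ≡ j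
  edge-injective i j i<n j<n e = node-injective d i j i<n j<n (edgeIndex-injective _ _ d e)

  v≡node-n : v ≡ node d (suc m)
  v≡node-n = sym (trans (cong (node d) (sym (+-identityʳ n))) (node-period d 0))

  port-forward : ∀ (F : Faults n) i → faultyPort F (node d i) d ≡ lookup F (edge i)
  port-forward F i = faultyPort-edge F (node d i) d

  port-backward : ∀ (F : Faults n) i → faultyPort F (node d (suc i)) (opp d) ≡ lookup F (edge i)
  port-backward F i = trans (faultyPort-edge F _ (opp d))
    (cong (lookup F) (trans (cong (λ u → edgeIndex u (opp d)) (node-suc d i)) (edgeIndex-opp (node d i) d)))

  port-behind-v : ∀ (F : Faults n) → faultyPort F v (opp d) ≡ lookup F (edge m)
  port-behind-v F = trans (cong (λ u → faultyPort F u (opp d)) v≡node-n) (port-backward F m)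

  node-opp : ∀ j x → node d (x + j) ≡ v → node (opp d) j ≡ node d x
  node-opp zero    x e = trans (sym e) (cong (node d) (+-identityʳ x))
  node-opp (suc j) x e = begin
      node (opp d) (suc j)          ≡⟨ node-suc (opp d) j ⟩
      move (node (opp d) j) (opp d) ≡⟨ cong (λ u → move u (opp d)) (node-opp j (suc x) (trans (cong (node d) (sym (+-suc x j))) e)) ⟩
      move (node d (suc x)) (opp d) ≡⟨ node-back d x ⟩
      node d x                      ∎
    where open ≡-Reasoning

  isEdgeOf : ℕ → ℕ → Fin n → Bool
  isEdgeOf a₁ a₂ e = ⌊ e ≟ edge a₁ ⌋ ∨ ⌊ e ≟ edge a₂ ⌋

  twoFaults : ℕ → ℕ → Faults n
  twoFaults a₁ a₂ = tabulate (isEdgeOf a₁ a₂)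

  twoFaults-first : ∀ a₁ a₂ → lookup (twoFaults a₁ a₂) (edge a₁) ≡ true
  twoFaults-first a₁ a₂ = trans (lookup∘tabulate (isEdgeOf a₁ a₂) (edge a₁))
    (cong (_∨ ⌊ edge a₁ ≟ edge a₂ ⌋) (⌊⌋-true (edge a₁ ≟ edge a₁) refl))

  twoFaults-second : ∀ a₁ a₂ → lookup (twoFaults a₁ a₂) (edge a₂) ≡ true
  twoFaults-second a₁ a₂ = trans (lookup∘tabulate (isEdgeOf a₁ a₂) (edge a₂))
    (trans (cong (⌊ edge a₂ ≟ edge a₁ ⌋ ∨_) (⌊⌋-true (edge a₂ ≟ edge a₂) refl)) (∨-zeroʳ _))

  twoFaults-other : ∀ a₁ a₂ i → i < n → a₁ < n → a₂ < n → ¬ (i ≡ a₁) → ¬ (i ≡ a₂) →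
    lookup (twoFaults a₁ a₂) (edge i) ≡ false
  twoFaults-other a₁ a₂ i i<n a₁<n a₂<n i≢a₁ i≢a₂ = trans (lookup∘tabulate (isEdgeOf a₁ a₂) (edge i))
    (cong₂ _∨_ (⌊⌋-false (edge i ≟ edge a₁) (λ e → i≢a₁ (edge-injective i a₁ i<n a₁<n e)))
               (⌊⌋-false (edge i ≟ edge a₂) (λ e → i≢a₂ (edge-injective i a₂ i<n a₂<n e))))

  as-forward : ∀ δ j → j < n → Σ ℕ (λ x → x < n × node d x ≡ node δ j)
  as-forward δ j j<n with same-or-opp δ d
  ... | inj₁ refl = j , j<n , refl
  as-forward δ zero    _         | inj₂ refl = 0 , s≤s z≤n , refl
  as-forward δ (suc j) (s≤s j<m) | inj₂ refl = m ∸ j , s≤s (m∸n≤m m j) ,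
    sym (node-opp (suc j) (m ∸ j) (trans (cong (node d) (trans (+-suc (m ∸ j) j) (cong suc (m∸n+n≡m (<⇒≤ j<m))))) (sym v≡node-n)))

initVisited : ∀ {n} → Fin n → Fin n → Bool
initVisited v = mark (λ _ → false) v

module Execution (m : ℕ) (v : Fin (suc m)) (F : Faults (suc m)) where
  open Ring m
  open From v

  Visited : Set
  Visited = Fin n → Bool

  mark-self : ∀ (vis : Visited) u → mark vis u u ≡ true
  mark-self vis u rewrite ⌊⌋-true (u ≟ u) refl = ∨-zeroʳ (vis u)

  mark-keep : ∀ (vis : Visited) u w → vis w ≡ true → mark vis u w ≡ true
  mark-keep vis u w e rewrite e = refl

  mark-other : ∀ (vis : Visited) u w → vis w ≡ false → ¬ (w ≡ u) → mark vis u w ≡ false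
  mark-other vis u w e w≢u rewrite e = ⌊⌋-false (w ≟ u) w≢u

  visitedAlong : Visited → (ℕ → Fin n) → ℕ → Visited
  visitedAlong vis g zero    = vis
  visitedAlong vis g (suc t) = visitedAlong (mark vis (g 1)) (λ i → g (suc i)) t

  along-keep : ∀ vis g t w → vis w ≡ true → visitedAlong vis g t w ≡ true
  along-keep vis g zero    w e = e
  along-keep vis g (suc t) w e = along-keep (mark vis (g 1)) (λ i → g (suc i)) t w (mark-keep vis (g 1) w e)

  along-visits : ∀ vis g t i → 1 ≤ i → i ≤ t → visitedAlong vis g t (g i) ≡ true
  along-visits vis g (suc t) (suc zero)    _ _ =
    along-keep (mark vis (g 1)) (λ i → g (suc i)) t (g 1) (mark-self vis (g 1))
  along-visits vis g (suc t) (suc (suc i)) _ (s≤s i≤t) =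
    along-visits (mark vis (g 1)) (λ i → g (suc i)) t (suc i) (s≤s z≤n) i≤t

  along-avoids : ∀ vis g t w → vis w ≡ false → (∀ i → 1 ≤ i → i ≤ t → ¬ (g i ≡ w)) →
    visitedAlong vis g t w ≡ false
  along-avoids vis g zero    w e h = e
  along-avoids vis g (suc t) w e h = along-avoids (mark vis (g 1)) (λ i → g (suc i)) t w
    (mark-other vis (g 1) w e (λ eq → h 1 ≤-refl (s≤s z≤n) (sym eq)))
    (λ i _ le → h (suc i) (s≤s z≤n) (s≤s le))

  covered-intro : ∀ vis → (∀ w → inC F v w ≡ true → vis w ≡ true) → covered F v vis ≡ true
  covered-intro vis h = all-intro _ (allFin n) λ w → visited-or-outside w (inC F v w) refl
    where
      visited-or-outside : ∀ w b → inC F v w ≡ b → not b ∨ vis w ≡ true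
      visited-or-outside w true  e = h w e
      visited-or-outside w false e = refl

  covered-elim : ∀ vis w → covered F v vis ≡ true → inC F v w ≡ true → vis w ≡ true
  covered-elim vis w c w∈C with all-elim _ (allFin n) c (∈-allFin w)
  ... | r rewrite w∈C = r

  covered-missing : ∀ vis w → inC F v w ≡ true → vis w ≡ false → covered F v vis ≡ false
  covered-missing vis w w∈C unvisited with covered F v vis in eq
  ... | false = refl
  ... | true  = false≡true-elim (trans (sym unvisited) (covered-elim vis w eq w∈C))

  run-covered : ∀ f md u vis → covered F v vis ≡ true → run f F v md u vis ≡ 0
  run-covered f md u vis c rewrite c = refl

  run-step-≤ : ∀ f md u vis δ md' → next F md u ≡ just (δ , md') →
    run (suc f) F v md u vis ≤ suc (run f F v md' (move u δ) (mark vis (move u δ)))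
  run-step-≤ f md u vis δ md' e with covered F v vis
  ... | true  = z≤n
  ... | false rewrite e = ≤-refl

  run-step-≡ : ∀ f md u vis δ md' → covered F v vis ≡ false → next F md u ≡ just (δ , md') →
    run (suc f) F v md u vis ≡ suc (run f F v md' (move u δ) (mark vis (move u δ)))
  run-step-≡ f md u vis δ md' c e rewrite c | e = refl

  Straight : ℕ → (ℕ → Fin n) → Dir → (ℕ → Mode) → Set
  Straight t g δ md = ∀ i → i < t → g (suc i) ≡ move (g i) δ × next F (md i) (g i) ≡ just (δ , md (suc i))

  run-straight-≤ : ∀ t g δ md vis X → Straight t g δ md →
    (∀ f → run f F v (md t) (g t) (visitedAlong vis g t) ≤ X) →
    ∀ f → run f F v (md 0) (g 0) vis ≤ t + X
  run-straight-≤ zero    g δ md vis X s h f    = h f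
  run-straight-≤ (suc t) g δ md vis X s h zero with covered F v vis
  ... | true  = z≤n
  ... | false = z≤n
  run-straight-≤ (suc t) g δ md vis X s h (suc f) =
    ≤-trans (run-step-≤ f (md 0) (g 0) vis δ (md 1) (proj₂ (s 0 (s≤s z≤n))))
      (s≤s (subst (λ x → run f F v (md 1) x (mark vis x) ≤ t + X) (proj₁ (s 0 (s≤s z≤n)))
        (run-straight-≤ t (λ i → g (suc i)) δ (λ i → md (suc i)) (mark vis (g 1)) X (λ i lt → s (suc i) (s≤s lt)) h f)))

  run-straight-≡ : ∀ t g δ md vis → Straight t g δ md →
    (∀ i → i < t → covered F v (visitedAlong vis g i) ≡ false) →
    ∀ f → run (t + f) F v (md 0) (g 0) vis ≡ t + run f F v (md t) (g t) (visitedAlong vis g t)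
  run-straight-≡ zero    g δ md vis s nc f = refl
  run-straight-≡ (suc t) g δ md vis s nc f =
    trans (run-step-≡ (t + f) (md 0) (g 0) vis δ (md 1) (nc 0 (s≤s z≤n)) (proj₂ (s 0 (s≤s z≤n))))
      (cong suc (trans (cong (λ x → run (t + f) F v (md 1) x (mark vis x)) (sym (proj₁ (s 0 (s≤s z≤n)))))
        (run-straight-≡ t (λ i → g (suc i)) δ (λ i → md (suc i)) (mark vis (g 1))
          (λ i lt → s (suc i) (s≤s lt)) (λ i lt → nc (suc i) (s≤s lt)) f)))

  freeRun-elim : ∀ u δ j i → freeRun F u δ j ≡ true → i < j → faultyPort F (iter i (step δ) u) δ ≡ false
  freeRun-elim u δ (suc j) zero e lt with faultyPort F u δ
  ... | false = refl
  ... | true  = false≡true-elim e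
  freeRun-elim u δ (suc j) (suc i) e (s≤s lt) with faultyPort F u δ
  ... | false = freeRun-elim (move u δ) δ j i e lt
  ... | true  = false≡true-elim e

  freeRun-intro : ∀ u δ j → (∀ i → i < j → faultyPort F (iter i (step δ) u) δ ≡ false) → freeRun F u δ j ≡ true
  freeRun-intro u δ zero    h = refl
  freeRun-intro u δ (suc j) h rewrite h 0 (s≤s z≤n) = freeRun-intro (move u δ) δ j (λ i lt → h (suc i) (s≤s lt))

  ReachedBy : Dir → Fin n → Set
  ReachedBy δ w = Σ ℕ (λ j → j < n × node δ j ≡ w × freeRun F v δ j ≡ true)

  reachDir-elim : ∀ w δ → reachDir F v w δ ≡ true → ReachedBy δ w
  reachDir-elim w δ e with any-elim _ (upTo n) e
  ... | j , mem , fj with ∧-true fj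
  ...   | hit , free = j , ∈-upTo⁻ mem , ⌊⌋-sound (node δ j ≟ w) hit , free

  reachDir-intro : ∀ w δ j → j < n → node δ j ≡ w → freeRun F v δ j ≡ true → reachDir F v w δ ≡ true
  reachDir-intro w δ j lt eq free = any-intro _ (upTo n) (∈-upTo⁺ lt)
    (subst (λ b → ⌊ node δ j ≟ w ⌋ ∧ b ≡ true) (sym free) (trans (∧-identityʳ _) (⌊⌋-true (node δ j ≟ w) eq)))

  inC-elim : ∀ w → inC F v w ≡ true → Σ Dir (λ δ → ReachedBy δ w)
  inC-elim w e with ∨-true e
  ... | inj₁ l = left  , reachDir-elim w left l
  ... | inj₂ r = right , reachDir-elim w right r

  inC-intro : ∀ w δ j → j < n → node δ j ≡ w → freeRun F v δ j ≡ true → inC F v w ≡ true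
  inC-intro w left  j lt eq free rewrite reachDir-intro w left  j lt eq free = refl
  inC-intro w right j lt eq free rewrite reachDir-intro w right j lt eq free = ∨-zeroʳ _

  walk-straight : ∀ t g δ vis rest → (∀ i → i < t → g (suc i) ≡ move (g i) δ × faultyPort F (g i) δ ≡ false) →
    walkCovers F v (g 0) vis (replicate t δ ++ rest) ≡ walkCovers F v (g t) (visitedAlong vis g t) rest
  walk-straight zero    g δ vis rest h = refl
  walk-straight (suc t) g δ vis rest h rewrite proj₂ (h 0 (s≤s z≤n)) | sym (proj₁ (h 0 (s≤s z≤n))) =
    walk-straight t (λ i → g (suc i)) δ (mark vis (g 1)) rest (λ i lt → h (suc i) (s≤s lt))

  uncovered-along : ∀ w vis g t → inC F v w ≡ true → vis w ≡ false → (∀ j → 1 ≤ j → j ≤ t → ¬ (g j ≡ w)) →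
    ∀ i → i ≤ t → covered F v (visitedAlong vis g i) ≡ false
  uncovered-along w vis g t w∈C unvisited avoid i i≤t = covered-missing _ w w∈C
    (along-avoids vis g i w unvisited (λ j 1≤j j≤i → avoid j 1≤j (≤-trans j≤i i≤t)))

  run-≥ : ∀ X fuel md u vis → (∀ f → X ≤ run (X + f) F v md u vis) → X ≤ fuel → X ≤ run fuel F v md u vis
  run-≥ X fuel md u vis h X≤fuel with m≤n⇒∃[o]m+o≡n X≤fuel
  ... | f , refl = h f

  opt-≤ : ∀ ds → walkCovers F v v (initVisited v) ds ≡ true → length ds ≤ 2 * n → opt F v ≤ length ds
  opt-≤ ds wc le = least-≤ (coverableIn F v) (2 * n) (length ds)
    (dirLists-intro (walkCovers F v v (initVisited v)) ds wc) le

  ≤-opt : ∀ k → k ≤ 2 * n → (∀ ds → walkCovers F v v (initVisited v) ds ≡ true → k ≤ length ds) → k ≤ opt F v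
  ≤-opt k k≤2n h = ≤-least (coverableIn F v) (2 * n) k shorter-fail k≤2n
    where
      shorter-fail : ∀ j → j < k → coverableIn F v j ≡ false
      shorter-fail j lt with coverableIn F v j in eq
      ... | false = refl
      ... | true with dirLists-elim j (walkCovers F v v (initVisited v)) eq
      ...   | ds , len , wc = ⊥-elim (<⇒≱ lt (subst (k ≤_) len (h ds wc)))

  opt-positive : ∀ w → inC F v w ≡ true → initVisited v w ≡ false → 1 ≤ opt F v
  opt-positive w w∈C unvisited = ≤-opt 1 (s≤s z≤n) nonempty
    where
      nonempty : ∀ ds → walkCovers F v v (initVisited v) ds ≡ true → 1 ≤ length ds
      nonempty []      wc = false≡true-elim (trans (sym (covered-missing (initVisited v) w w∈C unvisited)) wc)
      nonempty (_ ∷ _) wc = s≤s z≤n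

-- Lower bound for walks on a line.  Positions are natural numbers, the walk
-- starts at S (chosen large, so that it never goes below 0), has explored the
-- interval [lo, hi] and stands at p after t moves.  If it reached lo before
-- hi, it has paid (S - lo) + (hi - lo) + (hi - p) (`LeftFirst`); otherwise
-- (hi - S) + (hi - lo) + (p - lo) (`RightFirst`).  One of the two bounds is
-- preserved by every move, and at the end they give
-- t ≥ min (2(S - lo) + (hi - S), (S - lo) + 2(hi - S)).

twice : ℕ → ℕ
twice x = x + x

LeftFirst RightFirst : (S t lo hi p : ℕ) → Set
LeftFirst  S t lo hi p = S + twice hi ≤ t + (p + twice lo)
RightFirst S t lo hi p = twice hi + p ≤ t + (S + twice lo)

Explored : (S t lo hi p : ℕ) → Set
Explored S t lo hi p = LeftFirst S t lo hi p ⊎ RightFirst S t lo hi p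

explored-right : ∀ S t lo hi p → Explored S t lo hi p → Explored S (suc t) lo hi (suc p)
explored-right S t lo hi p (inj₁ h) = inj₁ (≤-trans h (+-mono-≤ (n≤1+n t) (n≤1+n _)))
explored-right S t lo hi p (inj₂ h) = inj₂ (subst (_≤ suc t + (S + twice lo)) (sym (+-suc (twice hi) p)) (s≤s h))

explored-extendRight : ∀ S t lo p → S ≤ p → Explored S t lo p p → Explored S (suc t) lo (suc p) (suc p)
explored-extendRight S t lo p _ (inj₁ h) =
  inj₁ (subst₂ _≤_ (sym (e₁ S p)) (sym (e₂ t p (twice lo))) (s≤s (s≤s h)))
  where
    e₁ : ∀ S p → S + (suc p + suc p) ≡ 2 + (S + (p + p))
    e₁ = solve-∀
    e₂ : ∀ t p L → suc t + (suc p + L) ≡ 2 + (t + (p + L))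
    e₂ = solve-∀
explored-extendRight S t lo p S≤p (inj₂ h) =
  inj₁ (subst₂ _≤_ (sym (e₃ S p)) (sym (e₄ t p (twice lo))) (+-monoˡ-≤ (2 + p) S+p≤))
  where
    e₁ : ∀ S p → S + (S + p) ≡ (S + S) + p
    e₁ = solve-∀
    e₂ : ∀ t S L → t + (S + L) ≡ S + (t + L)
    e₂ = solve-∀
    e₃ : ∀ S p → S + (suc p + suc p) ≡ (S + p) + (2 + p)
    e₃ = solve-∀
    e₄ : ∀ t p L → suc t + (suc p + L) ≡ (t + L) + (2 + p)
    e₄ = solve-∀
    S+p≤ : S + p ≤ t + twice lo
    S+p≤ = +-cancelˡ-≤ S _ _ (≤-trans (≤-reflexive (e₁ S p))
      (≤-trans (+-monoˡ-≤ p (+-mono-≤ S≤p S≤p)) (≤-trans h (≤-reflexive (e₂ t S (twice lo))))))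

explored-left : ∀ S t lo hi p → Explored S t lo hi (suc p) → Explored S (suc t) lo hi p
explored-left S t lo hi p (inj₁ h) = inj₁ (subst (S + twice hi ≤_) (+-suc t (p + twice lo)) h)
explored-left S t lo hi p (inj₂ h) = inj₂ (≤-trans (+-monoʳ-≤ (twice hi) (n≤1+n p)) (≤-trans h (n≤1+n _)))

explored-extendLeft : ∀ S t hi p → suc p ≤ S → Explored S t (suc p) hi (suc p) → Explored S (suc t) p hi p
explored-extendLeft S t hi p p<S (inj₁ h) = inj₂ (+-cancelˡ-≤ S _ _
    (≤-trans (≤-reflexive (e₁ S hi p)) (≤-trans (+-monoˡ-≤ p h)
      (≤-trans (≤-reflexive (e₂ t p)) (≤-trans (+-monoʳ-≤ (t + (twice p + 1)) (+-mono-≤ p<S p<S))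
        (≤-reflexive (e₃ t p S)))))))
  where
    e₁ : ∀ S hi p → S + ((hi + hi) + p) ≡ (S + (hi + hi)) + p
    e₁ = solve-∀
    e₂ : ∀ t p → t + (suc p + (suc p + suc p)) + p ≡ (t + ((p + p) + 1)) + (suc p + suc p)
    e₂ = solve-∀
    e₃ : ∀ t p S → (t + ((p + p) + 1)) + (S + S) ≡ S + (suc t + (S + (p + p)))
    e₃ = solve-∀
explored-extendLeft S t hi p _ (inj₂ h) = inj₂ (≤-pred (subst₂ _≤_ (e₁ hi p) (e₂ t S p) h))
  where
    e₁ : ∀ hi p → (hi + hi) + suc p ≡ suc ((hi + hi) + p)
    e₁ = solve-∀
    e₂ : ∀ t S p → t + (S + (suc p + suc p)) ≡ suc (suc t + (S + (p + p)))
    e₂ = solve-∀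

ExploreCost : (S t lo hi : ℕ) → Set
ExploreCost S t lo hi = (S + hi ≤ t + twice lo) ⊎ (twice hi ≤ t + (S + lo))

explored-cost : ∀ S t lo hi p → Explored S t lo hi p → lo ≤ p → p ≤ hi → ExploreCost S t lo hi
explored-cost S t lo hi p (inj₁ h) lo≤p p≤hi = inj₁ (+-cancelʳ-≤ hi _ _
  (subst₂ _≤_ (e₁ S hi) (e₂ t hi (twice lo)) (≤-trans h (+-monoʳ-≤ t (+-monoˡ-≤ (twice lo) p≤hi)))))
  where
    e₁ : ∀ S hi → S + (hi + hi) ≡ (S + hi) + hi
    e₁ = solve-∀
    e₂ : ∀ t hi L → t + (hi + L) ≡ (t + L) + hi
    e₂ = solve-∀
explored-cost S t lo hi p (inj₂ h) lo≤p p≤hi = inj₂ (+-cancelʳ-≤ lo _ _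
  (≤-trans (+-monoʳ-≤ (twice hi) lo≤p) (≤-trans h (≤-reflexive (e t S lo)))))
  where
    e : ∀ t S lo → t + (S + (lo + lo)) ≡ (t + (S + lo)) + lo
    e = solve-∀

two-sided-cost : ∀ S t lo hi a b → ExploreCost S t lo hi → lo + b ≤ S → S + a ≤ hi →
  (a + twice b ≤ t) ⊎ (twice a + b ≤ t)
two-sided-cost S t lo hi a b (inj₁ h) lo+b≤S S+a≤hi = inj₁ (+-cancelˡ-≤ (S + S) _ _
    (≤-trans (≤-reflexive (e₁ S a b)) (≤-trans (+-monoˡ-≤ (twice b) (+-monoʳ-≤ S S+a≤hi))
      (≤-trans (+-monoˡ-≤ (twice b) h) (≤-trans (≤-reflexive (e₂ t lo b))
        (≤-trans (+-monoʳ-≤ t (+-mono-≤ lo+b≤S lo+b≤S)) (≤-reflexive (e₃ t S))))))))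
  where
    e₁ : ∀ S a b → (S + S) + (a + (b + b)) ≡ S + (S + a) + (b + b)
    e₁ = solve-∀
    e₂ : ∀ t lo b → t + (lo + lo) + (b + b) ≡ t + ((lo + b) + (lo + b))
    e₂ = solve-∀
    e₃ : ∀ t S → t + (S + S) ≡ (S + S) + t
    e₃ = solve-∀
two-sided-cost S t lo hi a b (inj₂ h) lo+b≤S S+a≤hi = inj₂ (+-cancelˡ-≤ (S + S) _ _
    (≤-trans (≤-reflexive (e₁ S a b)) (≤-trans (+-monoˡ-≤ b (+-mono-≤ S+a≤hi S+a≤hi))
      (≤-trans (+-monoˡ-≤ b h) (≤-trans (≤-reflexive (e₂ t S lo b))
        (≤-trans (+-monoʳ-≤ (t + S) lo+b≤S) (≤-reflexive (e₃ t S))))))))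
  where
    e₁ : ∀ S a b → (S + S) + ((a + a) + b) ≡ ((S + a) + (S + a)) + b
    e₁ = solve-∀
    e₂ : ∀ t S lo b → t + (S + lo) + b ≡ t + S + (lo + b)
    e₂ = solve-∀
    e₃ : ∀ t S → t + S + S ≡ (S + S) + t
    e₃ = solve-∀

length-cost : ∀ S t lo hi k → ExploreCost S t lo hi → lo ≤ S → S ≤ hi → lo + k ≤ hi → k ≤ t
length-cost S t lo hi k (inj₁ h) lo≤S S≤hi lo+k≤hi = +-cancelˡ-≤ (twice lo) _ _
  (≤-trans (≤-reflexive (+-assoc lo lo k)) (≤-trans (+-mono-≤ lo≤S lo+k≤hi) (≤-trans h (≤-reflexive (+-comm t (twice lo))))))
length-cost S t lo hi k (inj₂ h) lo≤S S≤hi lo+k≤hi = +-cancelˡ-≤ (S + lo) _ _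
  (≤-trans (≤-reflexive (+-assoc S lo k)) (≤-trans (+-mono-≤ S≤hi lo+k≤hi) (≤-trans h (≤-reflexive (+-comm t (S + lo))))))

-- Covering walks on the ring, read on the unrolled line: position q stands
-- for the node at distance q to the right of v.

module WalkBound (m : ℕ) (v : Fin (suc m)) (F : Faults (suc m)) where
  open Ring m
  open From v
  open Edges m v right using (port-forward; port-backward)
  open Execution m v F

  pos : ℕ → Fin n
  pos = node right

  FreeBetween : ℕ → ℕ → Set
  FreeBetween lo hi = ∀ q → lo ≤ q → suc q ≤ hi → faultyPort F (pos q) right ≡ false

  Within : ℕ → ℕ → Fin n → Set
  Within lo hi w = Σ ℕ (λ q → lo ≤ q × q ≤ hi × pos q ≡ w)

  -- the state of a walk with t moves done and r moves still to come
  record Progress (S t r lo hi p : ℕ) (u : Fin n) (vis : Visited) : Set where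
    field
      at       : pos p ≡ u
      lo≤p     : lo ≤ p
      p≤hi     : p ≤ hi
      lo≤S     : lo ≤ S
      S≤hi     : S ≤ hi
      room     : r ≤ lo
      explored : Explored S t lo hi p
      free     : FreeBetween lo hi
      visited  : ∀ w → vis w ≡ true → Within lo hi w

  Walked : (S t r : ℕ) → Fin n → Visited → Set
  Walked S t r u vis = Σ ℕ λ lo → Σ ℕ λ hi → Σ ℕ λ p → Progress S t r lo hi p u vis

  visited-mark : ∀ vis lo hi q u → pos q ≡ u → lo ≤ q → q ≤ hi →
    (∀ w → vis w ≡ true → Within lo hi w) → ∀ w → mark vis u w ≡ true → Within lo hi w
  visited-mark vis lo hi q u eq lo≤q q≤hi old w e with ∨-true {vis w} e
  ... | inj₁ e₁ = old w e₁
  ... | inj₂ e₂ = q , lo≤q , q≤hi , trans eq (sym (⌊⌋-sound (w ≟ u) e₂))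

  within-widen : ∀ lo hi lo' hi' w → lo' ≤ lo → hi ≤ hi' → Within lo hi w → Within lo' hi' w
  within-widen lo hi lo' hi' w lo'≤lo hi≤hi' (q , lo≤q , q≤hi , eq) = q , ≤-trans lo'≤lo lo≤q , ≤-trans q≤hi hi≤hi' , eq

  step-right : ∀ {S t r u vis} → Walked S t (suc r) u vis → faultyPort F u right ≡ false →
    Walked S (suc t) r (move u right) (mark vis (move u right))
  step-right {S} {t} {r} {u} (lo , hi , p , pr) port-free with m≤n⇒m<n∨m≡n (Progress.p≤hi pr)
  ... | inj₁ p<hi = lo , hi , suc p , record
      { at = at' ; lo≤p = ≤-trans lo≤p (n≤1+n p) ; p≤hi = p<hi ; lo≤S = lo≤S ; S≤hi = S≤hi
      ; room = ≤-trans (n≤1+n _) room ; explored = explored-right S t lo hi p explored ; free = free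
      ; visited = visited-mark _ lo hi (suc p) _ at' (≤-trans lo≤p (n≤1+n p)) p<hi visited }
    where
      open Progress pr
      at' : pos (suc p) ≡ move u right
      at' = trans (node-suc right p) (cong (λ x → move x right) at)
  ... | inj₂ refl = lo , suc p , suc p , record
      { at = at' ; lo≤p = ≤-trans lo≤p (n≤1+n p) ; p≤hi = ≤-refl ; lo≤S = lo≤S ; S≤hi = ≤-trans S≤hi (n≤1+n p)
      ; room = ≤-trans (n≤1+n _) room ; explored = explored-extendRight S t lo p S≤hi explored ; free = free'
      ; visited = visited-mark _ lo (suc p) (suc p) _ at' (≤-trans lo≤p (n≤1+n p)) ≤-refl
          (λ w e → within-widen lo p lo (suc p) w ≤-refl (n≤1+n p) (visited w e)) }
    where
      open Progress pr
      at' : pos (suc p) ≡ move u right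
      at' = trans (node-suc right p) (cong (λ x → move x right) at)
      free' : FreeBetween lo (suc p)
      free' q lo≤q (s≤s q<p) with m≤n⇒m<n∨m≡n q<p
      ... | inj₁ lt   = free q lo≤q lt
      ... | inj₂ refl = trans (cong (λ x → faultyPort F x right) at) port-free

  -- a move left either stays inside [lo, hi] or extends it by one; the
  -- room r ≤ lo keeps the position positive
  step-left : ∀ {S t r u vis} → Walked S t (suc r) u vis → faultyPort F u left ≡ false →
    Walked S (suc t) r (move u left) (mark vis (move u left))
  step-left (lo , hi , zero , pr) _ = ⊥-elim (1+n≰n (≤-trans (Progress.room pr) (≤-trans (Progress.lo≤p pr) z≤n)))
  step-left {S} {t} {r} {u} (lo , hi , suc p , pr) port-free with lo ≤? p
  ... | yes lo≤p' = lo , hi , p , record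
      { at = at' ; lo≤p = lo≤p' ; p≤hi = ≤-trans (n≤1+n p) p≤hi ; lo≤S = lo≤S ; S≤hi = S≤hi
      ; room = ≤-trans (n≤1+n _) room ; explored = explored-left S t lo hi p explored ; free = free
      ; visited = visited-mark _ lo hi p _ at' lo≤p' (≤-trans (n≤1+n p) p≤hi) visited }
    where
      open Progress pr
      at' : pos p ≡ move u left
      at' = trans (sym (node-back right p)) (cong (λ x → move x left) at)
  ... | no lo≰p with ≤-antisym (Progress.lo≤p pr) (≰⇒> lo≰p)
  ...   | refl = p , hi , p , record
      { at = at' ; lo≤p = ≤-refl ; p≤hi = ≤-trans (n≤1+n p) p≤hi ; lo≤S = ≤-trans (n≤1+n p) lo≤S ; S≤hi = S≤hi
      ; room = ≤-pred room ; explored = explored-extendLeft S t hi p lo≤S explored ; free = free'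
      ; visited = visited-mark _ p hi p _ at' ≤-refl (≤-trans (n≤1+n p) p≤hi)
          (λ w e → within-widen (suc p) hi p hi w (n≤1+n p) ≤-refl (visited w e)) }
    where
      open Progress pr
      at' : pos p ≡ move u left
      at' = trans (sym (node-back right p)) (cong (λ x → move x left) at)
      crossed-free : faultyPort F (pos p) right ≡ false
      crossed-free = trans (port-forward F p) (trans (sym (port-backward F p))
        (trans (cong (λ x → faultyPort F x left) at) port-free))
      free' : FreeBetween p hi
      free' q p≤q q<hi with m≤n⇒m<n∨m≡n p≤q
      ... | inj₁ p<q  = free q p<q q<hi
      ... | inj₂ refl = crossed-free

  record Summary (S t : ℕ) : Set where
    field
      lo hi  : ℕ
      lo≤S   : lo ≤ S
      S≤hi   : S ≤ hi
      paid   : ExploreCost S t lo hi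
      free   : FreeBetween lo hi
      covers : ∀ w → inC F v w ≡ true → Within lo hi w

  walk-summary : ∀ ds {S t u vis} → Walked S t (length ds) u vis → walkCovers F v u vis ds ≡ true →
    Summary S (t + length ds)
  walk-summary [] {S} {t} (lo , hi , p , pr) wc = subst (Summary S) (sym (+-identityʳ t)) record
      { lo = lo ; hi = hi ; lo≤S = lo≤S ; S≤hi = S≤hi ; paid = explored-cost S t lo hi p explored lo≤p p≤hi
      ; free = free ; covers = λ w w∈C → visited w (covered-elim _ w wc w∈C) }
    where open Progress pr
  walk-summary (δ ∷ ds) {S} {t} {u} w wc with ∧-true {not (faultyPort F u δ)} wc
  walk-summary (right ∷ ds) {S} {t} w wc | port-free , rest =
    subst (Summary S) (sym (+-suc t (length ds))) (walk-summary ds (step-right w (not-true port-free)) rest)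
  walk-summary (left ∷ ds) {S} {t} w wc | port-free , rest =
    subst (Summary S) (sym (+-suc t (length ds))) (walk-summary ds (step-left w (not-true port-free)) rest)

  pos-multiple : ∀ c j → pos (c * n + j) ≡ pos j
  pos-multiple zero    j = refl
  pos-multiple (suc c) j = trans (cong pos (+-assoc n (c * n) j)) (trans (node-period right (c * n + j)) (pos-multiple c j))

  pos-multiple-v : ∀ c → pos (c * n) ≡ v
  pos-multiple-v c = trans (cong pos (sym (+-identityʳ (c * n)))) (pos-multiple c 0)

  pos-reduce : ∀ y → Σ ℕ (λ x → x < n × pos y ≡ pos x)
  pos-reduce zero = 0 , s≤s z≤n , refl
  pos-reduce (suc y) with pos-reduce y
  ... | x , x<n , eq with m≤n⇒m<n∨m≡n x<n
  ...   | inj₁ x<m = suc x , x<m , trans (node-suc right y) (trans (cong (λ u → move u right) eq) (sym (node-suc right x)))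
  ...   | inj₂ x≡m = 0 , s≤s z≤n , trans (node-suc right y) (trans (cong (λ u → move u right) eq)
          (trans (sym (node-suc right x)) (trans (cong pos x≡m) (trans (cong pos (sym (+-identityʳ n))) (node-period right 0)))))

  covering-walk : ∀ ds → walkCovers F v v (initVisited v) ds ≡ true → Σ ℕ (λ c → Summary (suc c * n) (length ds))
  covering-walk ds wc = length ds , walk-summary ds (S , S , S , start) wc
    where
      c : ℕ
      c = suc (length ds)
      S : ℕ
      S = c * n
      start : Progress S 0 (length ds) S S S v (initVisited v)
      start = record
        { at = pos-multiple-v c ; lo≤p = ≤-refl ; p≤hi = ≤-refl ; lo≤S = ≤-refl ; S≤hi = ≤-refl
        ; room = ≤-trans (n≤1+n _) (≤-trans (≤-reflexive (sym (*-identityʳ c))) (*-monoʳ-≤ c (s≤s z≤n)))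
        ; explored = inj₁ ≤-refl
        ; free = λ q S≤q q<S → ⊥-elim (<-irrefl refl (≤-trans q<S S≤q))
        ; visited = λ w e → S , ≤-refl , ≤-refl , only-v w e }
        where
          only-v : ∀ w → initVisited v w ≡ true → pos S ≡ w
          only-v w e with ∨-true {false} e
          ... | inj₂ e₂ = trans (pos-multiple-v c) (sym (⌊⌋-sound (w ≟ v) e₂))

  pos-window : ∀ lo q y → lo ≤ q → q ≤ y → y ≤ lo + m → pos q ≡ pos y → q ≡ y
  pos-window lo q y lo≤q q≤y y≤lo+m same with m≤n⇒∃[o]m+o≡n q≤y
  ... | k , refl = sym (trans (cong (q +_) k≡0) (+-identityʳ q))
    where
      k≡0 : k ≡ 0
      k≡0 = node-return right q k (sym same) (s≤s (+-cancelˡ-≤ q k m (≤-trans y≤lo+m (+-monoˡ-≤ m lo≤q))))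

three-legs-fuel : ∀ n k a b c → a ≤ n → b ≤ n → c ≤ n → a + (b + c) ≤ 2 * n * (k + 3)
three-legs-fuel n k a b c a≤n b≤n c≤n =
  ≤-trans (+-mono-≤ a≤n (+-mono-≤ b≤n c≤n))
    (≤-trans (m≤m+n _ (3 * n)) (≤-trans (≤-reflexive (e n)) (*-monoʳ-≤ (2 * n) (m≤n+m 3 k))))
  where
    e : ∀ x → x + (x + x) + 3 * x ≡ 2 * x * 3
    e = solve-∀

-- Lower bound, first case: the first leg is short, z₁ ≤ n - 3.  With faults
-- on the edge just behind v and on edge z₁ + 1 ahead, C is the segment from v
-- to the node `far` at distance z₁ + 1.  The agent goes z₁ ahead, returns z₁
-- to v (z₂ ≥ 1 makes it continue), meets the fault behind v and walks z₁ + 1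
-- ahead again: it pays 3z₁ + 1 while opt ≤ z₁ + 1.

module ShortFirstLeg (m' : ℕ) (v : Fin (suc (suc (suc m')))) (d : Dir) (y₁ y₂ : ℕ) (rest : List ℕ)
                     (short : suc y₁ ≤ m') where
  m : ℕ
  m = suc (suc m')
  open Ring m
  open From v
  open Edges m v d

  z₁ z₂ : ℕ
  z₁ = suc y₁
  z₂ = suc y₂

  faults : Faults n
  faults = twoFaults m (suc z₁)

  open Execution m v faults

  z₁<m : z₁ < m
  z₁<m = ≤-trans (s≤s short) (n≤1+n _)

  z₁+1<n : suc z₁ < n
  z₁+1<n = s≤s (s≤s (≤-trans short (n≤1+n _)))

  z₁<n : z₁ < n
  z₁<n = <-trans z₁<m (n<1+n m)

  free-ahead : ∀ i → i ≤ z₁ → lookup faults (edge i) ≡ false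
  free-ahead i i≤z₁ = twoFaults-other m (suc z₁) i (≤-<-trans i≤z₁ z₁<n) (n<1+n m) z₁+1<n
    (λ e → <-irrefl e (≤-<-trans i≤z₁ z₁<m)) (λ e → <-irrefl e (s≤s i≤z₁))

  laterLegs : List ℕ
  laterLegs = pairSums z₂ rest

  far : Fin n
  far = node d (suc z₁)

  far-not-before : ∀ j → j ≤ z₁ → ¬ (node d j ≡ far)
  far-not-before j j≤z₁ e = <-irrefl (node-injective d j (suc z₁) (≤-<-trans j≤z₁ z₁<n) z₁+1<n e) (s≤s j≤z₁)

  far-unvisited : initVisited v far ≡ false
  far-unvisited = mark-other (λ _ → false) v far refl (λ e → far-not-before 0 z≤n (sym e))

  far∈C : inC faults v far ≡ true
  far∈C = inC-intro far d (suc z₁) z₁+1<n refl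
    (freeRun-intro v d (suc z₁) (λ i lt → trans (port-forward faults i) (free-ahead i (≤-pred lt))))

  out-modes : ℕ → Mode
  out-modes i = legs d (z₁ ∸ i) ((z₁ + z₂) ∷ laterLegs)

  out : Straight z₁ (node d) d out-modes
  out i i<z₁ = node-suc d i , next-out
    where
      next-out : next faults (out-modes i) (node d i) ≡ just (d , out-modes (suc i))
      next-out rewrite ∸-suc z₁ i i<z₁ | port-forward faults i | free-ahead i (<⇒≤ i<z₁) = refl

  afterOut : Visited
  afterOut = visitedAlong (initVisited v) (node d) z₁

  afterOut-far : afterOut far ≡ false
  afterOut-far = along-avoids (initVisited v) (node d) z₁ far far-unvisited (λ j _ j≤z₁ → far-not-before j j≤z₁)

  back-nodes : ℕ → Fin n
  back-nodes i = node d (z₁ ∸ i)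

  back-modes : ℕ → Mode
  back-modes zero    = out-modes z₁
  back-modes (suc i) = legs (opp d) (y₁ + z₂ ∸ i) laterLegs

  back : Straight z₁ back-nodes (opp d) back-modes
  back zero _ = sym (node-back d y₁) , next-turn
    where
      next-turn : next faults (back-modes 0) (back-nodes 0) ≡ just (opp d , back-modes 1)
      next-turn rewrite n∸n≡0 y₁ | port-backward faults y₁ | free-ahead y₁ (n≤1+n _) = refl
  back (suc i) (s≤s i<y₁) = moved , next-back
    where
      moved : back-nodes (suc (suc i)) ≡ move (back-nodes (suc i)) (opp d)
      moved rewrite ∸-suc y₁ i i<y₁ = sym (node-back d (y₁ ∸ suc i))
      next-back : next faults (back-modes (suc i)) (back-nodes (suc i)) ≡ just (opp d , back-modes (suc (suc i)))
      next-back rewrite ∸-suc (y₁ + z₂) i (≤-trans i<y₁ (m≤m+n y₁ z₂)) | ∸-suc y₁ i i<y₁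
                      | port-backward faults (y₁ ∸ suc i) | free-ahead (y₁ ∸ suc i) (≤-trans (m∸n≤m y₁ (suc i)) (n≤1+n _)) = refl

  back-avoids : ∀ j → 1 ≤ j → j ≤ z₁ → ¬ (back-nodes j ≡ far)
  back-avoids j _ _ = far-not-before (z₁ ∸ j) (m∸n≤m z₁ j)

  afterBack : Visited
  afterBack = visitedAlong afterOut back-nodes z₁

  again-nodes : ℕ → Fin n
  again-nodes zero    = back-nodes z₁
  again-nodes (suc i) = node d (suc i)

  again-modes : ℕ → Mode
  again-modes zero    = back-modes z₁
  again-modes (suc i) = free2 d

  again : Straight (suc z₁) again-nodes d again-modes
  again zero _ = moved , next-bounce
    where
      moved : again-nodes 1 ≡ move (again-nodes 0) d
      moved rewrite n∸n≡0 y₁ = refl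
      next-bounce : next faults (again-modes 0) (again-nodes 0) ≡ just (d , again-modes 1)
      next-bounce rewrite m+n∸m≡n y₁ z₂ | n∸n≡0 y₁ | port-behind-v faults | twoFaults-first m (suc z₁)
                        | opp-involutive d | port-forward faults 0 | free-ahead 0 z≤n = refl
  again (suc i) (s≤s i<z₁) = node-suc d (suc i) , next-again
    where
      next-again : next faults (again-modes (suc i)) (again-nodes (suc i)) ≡ just (d , again-modes (suc (suc i)))
      next-again rewrite port-forward faults (suc i) | free-ahead (suc i) i<z₁ = refl

  again-avoids : ∀ j → 1 ≤ j → j ≤ z₁ → ¬ (again-nodes j ≡ far)
  again-avoids (suc j) _ j<z₁ = far-not-before (suc j) j<z₁

  -- while far is unvisited, every move of the three legs is paid
  legs-cost : ∀ f → run (z₁ + (z₁ + (suc z₁ + f))) faults v (out-modes 0) v (initVisited v) ≡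
    z₁ + (z₁ + (suc z₁ + run f faults v (again-modes (suc z₁)) (again-nodes (suc z₁)) (visitedAlong afterBack again-nodes (suc z₁))))
  legs-cost f =
    trans (run-straight-≡ z₁ (node d) d out-modes (initVisited v) out
            (λ i i<z₁ → uncovered-along far _ (node d) z₁ far∈C far-unvisited (λ j _ j≤z₁ → far-not-before j j≤z₁) i (<⇒≤ i<z₁)) _)
    (cong (z₁ +_) (trans (run-straight-≡ z₁ back-nodes (opp d) back-modes afterOut back
            (λ i i<z₁ → uncovered-along far _ back-nodes z₁ far∈C afterOut-far back-avoids i (<⇒≤ i<z₁)) _)
    (cong (z₁ +_) (run-straight-≡ (suc z₁) again-nodes d again-modes afterBack again
            (λ i i<z₁+1 → uncovered-along far _ again-nodes z₁ far∈C
              (along-avoids afterOut back-nodes z₁ far afterOut-far back-avoids) again-avoids i (≤-pred i<z₁+1)) f))))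

  cost-≥ : ∀ k → z₁ + (z₁ + suc z₁) ≤ run (2 * n * (k + 3)) faults v (out-modes 0) v (initVisited v)
  cost-≥ k = run-≥ X _ (out-modes 0) v (initVisited v) three-legs
      (three-legs-fuel n k z₁ z₁ (suc z₁) (<⇒≤ z₁<n) (<⇒≤ z₁<n) (<⇒≤ z₁+1<n))
    where
      X : ℕ
      X = z₁ + (z₁ + suc z₁)
      regroup : ∀ r → z₁ + (z₁ + (suc z₁ + r)) ≡ X + r
      regroup r = sym (trans (+-assoc z₁ (z₁ + suc z₁) r) (cong (z₁ +_) (+-assoc z₁ (suc z₁) r)))
      three-legs : ∀ f → X ≤ run (X + f) faults v (out-modes 0) v (initVisited v)
      three-legs f = subst (λ fuel → X ≤ run fuel faults v (out-modes 0) v (initVisited v)) (regroup f)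
        (subst (X ≤_) (sym (legs-cost f)) (≤-trans (m≤m+n X _) (≤-reflexive (sym (regroup _)))))

  straight-covers : covered faults v (visitedAlong (initVisited v) (node d) (suc z₁)) ≡ true
  straight-covers = covered-intro _ λ w w∈C → visited w (inC-elim w w∈C)
    where
      visited : ∀ w → Σ Dir (λ δ → ReachedBy δ w) → visitedAlong (initVisited v) (node d) (suc z₁) w ≡ true
      visited w (δ , zero , _ , refl , _) = along-keep (initVisited v) (node d) (suc z₁) v (mark-self (λ _ → false) v)
      visited w (δ , suc j , _ , refl , free) with same-or-opp δ d
      ... | inj₂ refl = false≡true-elim (trans (sym (freeRun-elim v (opp d) (suc j) 0 free (s≤s z≤n)))
                          (trans (port-behind-v faults) (twoFaults-first m (suc z₁))))
      ... | inj₁ refl with suc j ≤? suc z₁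
      ...   | yes j<z₁+1 = along-visits (initVisited v) (node d) (suc z₁) (suc j) (s≤s z≤n) j<z₁+1
      ...   | no  j≮z₁+1 = false≡true-elim (trans (sym (freeRun-elim v d (suc j) (suc z₁) free (≰⇒> j≮z₁+1)))
                          (trans (port-forward faults (suc z₁)) (twoFaults-second m (suc z₁))))

  opt-≤-far : opt faults v ≤ suc z₁
  opt-≤-far = subst (opt faults v ≤_) (length-replicate (suc z₁))
      (opt-≤ (replicate (suc z₁) d) walk (≤-trans (≤-reflexive (length-replicate (suc z₁))) (≤-trans (<⇒≤ z₁+1<n) (m≤m+n n _))))
    where
      walk : walkCovers faults v v (initVisited v) (replicate (suc z₁) d) ≡ true
      walk = trans (cong (walkCovers faults v v (initVisited v)) (sym (++-identityʳ (replicate (suc z₁) d))))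
        (trans (walk-straight (suc z₁) (node d) d (initVisited v) []
                 (λ i lt → node-suc d i , trans (port-forward faults i) (free-ahead i (≤-pred lt))))
               straight-covers)

  opt-≥1 : 1 ≤ opt faults v
  opt-≥1 = opt-positive far far∈C far-unvisited

-- Lower bound, second case: the first leg is long, z₁ ≥ n - 2 = M.  With the
-- single fault on edge M ahead, C is the whole ring seen as a path from node
-- M back around to `far`, the node just behind v.  The agent walks M ahead
-- (turning there on schedule if z₁ = M, or at the fault if z₁ > M), then M
-- back to v and one more step to far: it pays 2M + 1 = 2n - 3 while opt ≤ n.

module LongFirstLeg (m' : ℕ) (v : Fin (suc (suc (suc m')))) (d : Dir) (z₁ y₂ : ℕ) (rest : List ℕ)
                    (long : suc m' ≤ z₁) where
  M : ℕ
  M = suc m'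
  m : ℕ
  m = suc M
  open Ring m
  open From v
  open Edges m v d

  z₂ : ℕ
  z₂ = suc y₂

  faults : Faults n
  faults = twoFaults M M

  open Execution m v faults

  M<n : M < n
  M<n = ≤-trans (n<1+n M) (n≤1+n m)

  free-other : ∀ i → i < n → ¬ (i ≡ M) → lookup faults (edge i) ≡ false
  free-other i i<n i≢M = twoFaults-other M M i i<n M<n M<n i≢M i≢M

  free-ahead : ∀ i → i < M → lookup faults (edge i) ≡ false
  free-ahead i i<M = free-other i (<-trans i<M M<n) (λ e → <-irrefl e i<M)

  free-behind : lookup faults (edge m) ≡ false
  free-behind = free-other m (n<1+n m) (λ e → <-irrefl (sym e) (n<1+n M))

  v-behind-free : faultyPort faults v (opp d) ≡ false
  v-behind-free = trans (port-behind-v faults) free-behind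

  laterLegs : List ℕ
  laterLegs = pairSums z₂ rest

  far : Fin n
  far = node d m

  far-not-before : ∀ j → j ≤ M → ¬ (node d j ≡ far)
  far-not-before j j≤M e = <-irrefl (node-injective d j m (≤-<-trans j≤M M<n) (n<1+n m) e) (s≤s j≤M)

  far-unvisited : initVisited v far ≡ false
  far-unvisited = mark-other (λ _ → false) v far refl (λ e → far-not-before 0 z≤n (sym e))

  far∈C : inC faults v far ≡ true
  far∈C = inC-intro far (opp d) 1 (s≤s (s≤s z≤n)) (node-behind d)
    (freeRun-intro v (opp d) 1 λ { zero _ → v-behind-free ; (suc i) (s≤s ()) })

  out-modes : ℕ → Mode
  out-modes i = legs d (z₁ ∸ i) ((z₁ + z₂) ∷ laterLegs)

  out : Straight M (node d) d out-modes
  out i i<M = node-suc d i , next-out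
    where
      next-out : next faults (out-modes i) (node d i) ≡ just (d , out-modes (suc i))
      next-out rewrite ∸-suc z₁ i (≤-trans i<M long) | port-forward faults i | free-ahead i i<M = refl

  afterOut : Visited
  afterOut = visitedAlong (initVisited v) (node d) M

  afterOut-far : afterOut far ≡ false
  afterOut-far = along-avoids (initVisited v) (node d) M far far-unvisited (λ j _ j≤M → far-not-before j j≤M)

  back-nodes : ℕ → Fin n
  back-nodes i = node d (M ∸ i)

  back-free : ∀ i → i < M → faultyPort faults (back-nodes i) (opp d) ≡ false
  back-free i i<M rewrite ∸-suc M i i<M | port-backward faults (M ∸ suc i) = free-ahead (M ∸ suc i) (s≤s (m∸n≤m m' i))

  back-avoids : ∀ j → 1 ≤ j → j ≤ M → ¬ (back-nodes j ≡ far)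
  back-avoids j _ _ = far-not-before (M ∸ j) (m∸n≤m M j)

  afterBack : Visited
  afterBack = visitedAlong afterOut back-nodes M

  last-nodes : ℕ → Fin n
  last-nodes zero    = back-nodes M
  last-nodes (suc i) = far

  -- the cost bound, for any schedule that keeps moving back while possible
  module Returning (back-modes : ℕ → Mode) (turns : back-modes 0 ≡ out-modes M)
      (moves-back : ∀ i → i ≤ M → faultyPort faults (back-nodes i) (opp d) ≡ false →
                    next faults (back-modes i) (back-nodes i) ≡ just (opp d , back-modes (suc i))) where

    back : Straight M back-nodes (opp d) back-modes
    back i i<M = moved , moves-back i (<⇒≤ i<M) (back-free i i<M)
      where
        moved : back-nodes (suc i) ≡ move (back-nodes i) (opp d)
        moved rewrite ∸-suc M i i<M = sym (node-back d (M ∸ suc i))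

    last-modes : ℕ → Mode
    last-modes i = back-modes (M + i)

    last : Straight 1 last-nodes (opp d) last-modes
    last zero _ = moved , next-last
      where
        moved : last-nodes 1 ≡ move (last-nodes 0) (opp d)
        moved rewrite n∸n≡0 M = sym (node-behind d)
        v-free : faultyPort faults (back-nodes M) (opp d) ≡ false
        v-free rewrite n∸n≡0 M = v-behind-free
        next-last : next faults (last-modes 0) (last-nodes 0) ≡ just (opp d , last-modes 1)
        next-last = subst₂ (λ a b → next faults (back-modes a) (back-nodes M) ≡ just (opp d , back-modes b))
          (sym (+-identityʳ M)) (trans (cong suc (sym (+-identityʳ M))) (sym (+-suc M 0)))
          (moves-back M ≤-refl v-free)
    last (suc i) (s≤s ())

    legs-cost : ∀ f → run (M + (M + (1 + f))) faults v (out-modes 0) v (initVisited v) ≡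
      M + (M + (1 + run f faults v (last-modes 1) far (visitedAlong afterBack last-nodes 1)))
    legs-cost f = trans (run-straight-≡ M (node d) d out-modes (initVisited v) out
          (λ i i<M → uncovered-along far _ (node d) M far∈C far-unvisited (λ j _ j≤M → far-not-before j j≤M) i (<⇒≤ i<M)) _)
      (cong (M +_) (trans
        (subst (λ md → run (M + (1 + f)) faults v md (back-nodes 0) afterOut ≡
                       M + run (1 + f) faults v (back-modes M) (back-nodes M) afterBack) turns
          (run-straight-≡ M back-nodes (opp d) back-modes afterOut back
            (λ i i<M → uncovered-along far _ back-nodes M far∈C afterOut-far back-avoids i (<⇒≤ i<M)) (1 + f)))
        (cong (M +_) (subst (λ md → run (1 + f) faults v md (last-nodes 0) afterBack ≡
                                    1 + run f faults v (last-modes 1) far (visitedAlong afterBack last-nodes 1))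
          (cong back-modes (+-identityʳ M))
          (run-straight-≡ 1 last-nodes (opp d) last-modes afterBack last
            (λ { zero _ → covered-missing _ far far∈C (along-avoids afterOut back-nodes M far afterOut-far back-avoids)
               ; (suc i) (s≤s ()) }) f)))))

    cost-≥ : ∀ k → M + (M + 1) ≤ run (2 * n * (k + 3)) faults v (out-modes 0) v (initVisited v)
    cost-≥ k = run-≥ X _ (out-modes 0) v (initVisited v) three-legs
        (three-legs-fuel n k M M 1 (<⇒≤ M<n) (<⇒≤ M<n) (s≤s z≤n))
      where
        X : ℕ
        X = M + (M + 1)
        regroup : ∀ r → M + (M + (1 + r)) ≡ X + r
        regroup r = sym (trans (+-assoc M (M + 1) r) (cong (M +_) (+-assoc M 1 r)))
        three-legs : ∀ f → X ≤ run (X + f) faults v (out-modes 0) v (initVisited v)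
        three-legs f = subst (λ fuel → X ≤ run fuel faults v (out-modes 0) v (initVisited v)) (regroup f)
          (subst (X ≤_) (sym (legs-cost f)) (≤-trans (m≤m+n X _) (≤-reflexive (sym (regroup _)))))

  module OnSchedule (z₁≡M : z₁ ≡ M) where
    back-modes : ℕ → Mode
    back-modes zero    = out-modes M
    back-modes (suc i) = legs (opp d) (z₁ + z₂ ∸ suc i) laterLegs

    still-legs : ∀ i → suc i ≤ M → suc i < z₁ + z₂
    still-legs i i<M = ≤-trans (s≤s (subst (suc i ≤_) (sym z₁≡M) i<M))
      (≤-trans (s≤s (m≤m+n z₁ y₂)) (≤-reflexive (sym (+-suc z₁ y₂))))

    moves-back : ∀ i → i ≤ M → faultyPort faults (back-nodes i) (opp d) ≡ false →
      next faults (back-modes i) (back-nodes i) ≡ just (opp d , back-modes (suc i))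
    moves-back zero    _   port-free rewrite z₁≡M | n∸n≡0 M | port-free = refl
    moves-back (suc i) i<M port-free rewrite ∸-suc (z₁ + z₂) (suc i) (still-legs i i<M) | port-free = refl

    open Returning back-modes refl moves-back public

  module AtFault (M<z₁ : M < z₁) where
    back-modes : ℕ → Mode
    back-modes zero    = out-modes M
    back-modes (suc i) = free2 (opp d)

    moves-back : ∀ i → i ≤ M → faultyPort faults (back-nodes i) (opp d) ≡ false →
      next faults (back-modes i) (back-nodes i) ≡ just (opp d , back-modes (suc i))
    moves-back zero    _ port-free rewrite ∸-suc z₁ M M<z₁ | port-forward faults M | twoFaults-first M M | port-free = refl
    moves-back (suc i) _ port-free rewrite port-free = refl

    open Returning back-modes refl moves-back public

  cost-≥ : ∀ k → M + (M + 1) ≤ run (2 * n * (k + 3)) faults v (out-modes 0) v (initVisited v)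
  cost-≥ k with m≤n⇒m<n∨m≡n long
  ... | inj₁ M<z₁ = AtFault.cost-≥ M<z₁ k
  ... | inj₂ M≡z₁ = OnSchedule.cost-≥ (sym M≡z₁) k

  opt-≥1 : 1 ≤ opt faults v
  opt-≥1 = opt-positive far far∈C far-unvisited

  sweep-nodes : ℕ → Fin n
  sweep-nodes i = node d (i + m)

  sweep-wraps : ∀ x → sweep-nodes (suc x) ≡ node d x
  sweep-wraps x = trans (cong (node d) (trans (sym (+-suc x m)) (+-comm x n))) (node-period d x)

  afterBackStep : Visited
  afterBackStep = mark (initVisited v) far

  sweep-free : ∀ i → i < m → sweep-nodes (suc i) ≡ move (sweep-nodes i) d × faultyPort faults (sweep-nodes i) d ≡ false
  sweep-free zero    _         = node-suc d m , trans (port-forward faults m) free-behind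
  sweep-free (suc i) (s≤s i<M) = node-suc d (suc i + m) ,
    trans (port-forward faults (suc i + m)) (trans (cong (λ u → lookup faults (edgeIndex u d)) (sweep-wraps i)) (free-ahead i i<M))

  sweep-visits : ∀ x → x < n → visitedAlong afterBackStep sweep-nodes m (node d x) ≡ true
  sweep-visits zero    _ = along-keep afterBackStep sweep-nodes m v (mark-keep (initVisited v) far v (mark-self (λ _ → false) v))
  sweep-visits (suc x) (s≤s x<m) with m≤n⇒m<n∨m≡n x<m
  ... | inj₂ refl = along-keep afterBackStep sweep-nodes m far (mark-self (initVisited v) far)
  ... | inj₁ x<M  = subst (λ u → visitedAlong afterBackStep sweep-nodes m u ≡ true) (sweep-wraps (suc x))
                      (along-visits afterBackStep sweep-nodes m (suc (suc x)) (s≤s z≤n) x<M)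

  opt-≤-n : opt faults v ≤ n
  opt-≤-n = subst (opt faults v ≤_) (cong suc (length-replicate m)) (opt-≤ sweep walk
    (≤-trans (≤-reflexive (cong suc (length-replicate m))) (m≤m+n n _)))
    where
      sweep : List Dir
      sweep = opp d ∷ replicate m d
      sweep-covers : covered faults v (visitedAlong afterBackStep sweep-nodes m) ≡ true
      sweep-covers = covered-intro _ λ w w∈C → cover w (inC-elim w w∈C)
        where
          cover : ∀ w → Σ Dir (λ δ → ReachedBy δ w) → visitedAlong afterBackStep sweep-nodes m w ≡ true
          cover w (δ , j , j<n , refl , _) with as-forward δ j j<n
          ... | x , x<n , eq = subst (λ u → visitedAlong afterBackStep sweep-nodes m u ≡ true) eq (sweep-visits x x<n)
      walk : walkCovers faults v v (initVisited v) sweep ≡ true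
      walk rewrite v-behind-free | node-behind d =
        trans (cong (walkCovers faults v far afterBackStep) (sym (++-identityʳ (replicate m d))))
          (trans (walk-straight m sweep-nodes d afterBackStep [] sweep-free) sweep-covers)

-- Upper bound: the class-A_0 algorithm that goes right first.  For a fault
-- configuration F either no edge ahead of v is faulty (the agent sweeps the
-- ring and pays m, like every covering walk), or there are a first fault at
-- distance a ahead and a first fault at distance b behind, with a + b ≤ m.
-- Then C is the segment [-b, a]: the agent pays a if b = 0 and 2a + b
-- otherwise, and every covering walk pays a + 2b or 2a + b.

module RightSweep (m : ℕ) (v : Fin (suc m)) (F : Faults (suc m)) where
  open Ring m
  open From v
  open Edges m v right using (port-forward; port-backward; node-opp; v≡node-n)
  open Execution m v F
  open WalkBound m v F

  FaultAhead FaultBehind : ℕ → Bool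
  FaultAhead  i = faultyPort F (pos i) right
  FaultBehind j = faultyPort F (node left j) left

  record FirstFaults : Set where
    field
      a b      : ℕ
      fault-a  : FaultAhead a ≡ true
      before-a : ∀ i → i < a → FaultAhead i ≡ false
      fault-b  : FaultBehind b ≡ true
      before-b : ∀ j → j < b → FaultBehind j ≡ false
      a+b≤m    : a + b ≤ m

  fault-seen-behind : ∀ a → a ≤ m → FaultAhead a ≡ true → FaultBehind (m ∸ a) ≡ true
  fault-seen-behind a a≤m fault = trans (cong (λ u → faultyPort F u left) same-node)
      (trans (port-backward F a) (trans (sym (port-forward F a)) fault))
    where
      same-node : node left (m ∸ a) ≡ pos (suc a)
      same-node = node-opp (m ∸ a) (suc a) (trans (cong pos (cong suc (m+[n∸m]≡n a≤m))) (sym v≡node-n))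

  fault-shape : (∀ i → i < m → FaultAhead i ≡ false) ⊎ FirstFaults
  fault-shape with first-or-none FaultAhead m
  ... | inj₂ none = inj₁ none
  ... | inj₁ (a , a<m , fault-a , before-a) with first-or-none FaultBehind n
  ...   | inj₂ none = false≡true-elim (trans (sym (none (m ∸ a) (s≤s (m∸n≤m m a)))) (fault-seen-behind a (<⇒≤ a<m) fault-a))
  ...   | inj₁ (b , _ , fault-b , before-b) = inj₂ record
      { a = a ; b = b ; fault-a = fault-a ; before-a = before-a ; fault-b = fault-b ; before-b = before-b
      ; a+b≤m = a+b≤m }
    where
      a+b≤m : a + b ≤ m
      a+b≤m with b ≤? m ∸ a
      ... | yes b≤ = ≤-trans (+-monoʳ-≤ a b≤) (≤-reflexive (m+[n∸m]≡n (<⇒≤ a<m)))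
      ... | no  b≰ = false≡true-elim (trans (sym (before-b (m ∸ a) (≰⇒> b≰))) (fault-seen-behind a (<⇒≤ a<m) fault-a))

  sweep-right : ∀ a → (∀ i → i < a → FaultAhead i ≡ false) → Straight a pos right (λ _ → free1 right)
  sweep-right a before i i<a = node-suc right i , next-right
    where
      next-right : next F (free1 right) (pos i) ≡ just (right , free1 right)
      next-right rewrite before i i<a = refl

  visited-ahead : ∀ a j → j ≤ a → visitedAlong (initVisited v) pos a (pos j) ≡ true
  visited-ahead a zero    _   = along-keep (initVisited v) pos a v (mark-self (λ _ → false) v)
  visited-ahead a (suc j) j<a = along-visits (initVisited v) pos a (suc j) (s≤s z≤n) j<a

  inC-ahead : ∀ x → x < n → (∀ i → i < x → FaultAhead i ≡ false) → inC F v (pos x) ≡ true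
  inC-ahead x x<n before = inC-intro (pos x) right x x<n refl (freeRun-intro v right x before)

  inC-behind : ∀ x → x < n → (∀ i → i < x → FaultBehind i ≡ false) → inC F v (node left x) ≡ true
  inC-behind x x<n before = inC-intro (node left x) left x x<n refl (freeRun-intro v left x before)

  module NoFaultAhead (none : ∀ i → i < m → FaultAhead i ≡ false) where

    cost-≤ : ∀ fuel → run fuel F v (free1 right) v (initVisited v) ≤ m + 0
    cost-≤ = run-straight-≤ m pos right (λ _ → free1 right) (initVisited v) 0 (sweep-right m none)
        (λ f → ≤-reflexive (run-covered f (free1 right) (pos m) _ swept))
      where
        swept : covered F v (visitedAlong (initVisited v) pos m) ≡ true
        swept = covered-intro _ λ w w∈C → cover w (inC-elim w w∈C)
          where
            cover : ∀ w → Σ Dir (λ δ → ReachedBy δ w) → visitedAlong (initVisited v) pos m w ≡ true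
            cover w (δ , j , j<n , refl , _) with Edges.as-forward m v right δ j j<n
            ... | x , x<n , eq = subst (λ u → visitedAlong (initVisited v) pos m u ≡ true) eq
                                   (visited-ahead m x (≤-pred x<n))

    -- the explored interval must contain n distinct positions
    walk-≥ : ∀ ds → walkCovers F v v (initVisited v) ds ≡ true → m ≤ length ds
    walk-≥ ds wc with covering-walk ds wc
    ... | c , summary = length-cost (suc c * n) (length ds) lo hi m paid lo≤S S≤hi spans
      where
        open Summary summary
        spans : lo + m ≤ hi
        spans with lo + m ≤? hi
        ... | yes ok    = ok
        ... | no  short with pos-reduce (suc hi)
        ...   | x , x<n , wraps with covers (pos x) (inC-ahead x x<n (λ i i<x → none i (≤-trans i<x (≤-pred x<n))))
        ...     | q , lo≤q , q≤hi , eq = ⊥-elim (1+n≰n (subst (_≤ hi)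
                    (pos-window lo q (suc hi) lo≤q (≤-trans q≤hi (n≤1+n hi)) (≰⇒> short) (trans eq (sym wraps))) q≤hi))

    opt-≥ : m ≤ opt F v
    opt-≥ = ≤-opt m (≤-trans (n≤1+n m) (m≤m+n n _)) walk-≥

  module WithFaults (ff : FirstFaults) where
    open FirstFaults ff

    a<n : a < n
    a<n = s≤s (≤-trans (m≤m+n a b) a+b≤m)

    b<n : b < n
    b<n = s≤s (≤-trans (m≤n+m b a) a+b≤m)

    covered-segment : ∀ vis → (∀ j → j ≤ a → vis (pos j) ≡ true) → (∀ j → j ≤ b → vis (node left j) ≡ true) →
      covered F v vis ≡ true
    covered-segment vis ahead behind = covered-intro vis λ w w∈C → cover w (inC-elim w w∈C)
      where
        cover : ∀ w → Σ Dir (λ δ → ReachedBy δ w) → vis w ≡ true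
        cover w (right , j , _ , refl , free) with j ≤? a
        ... | yes j≤a = ahead j j≤a
        ... | no  j≰a = false≡true-elim (trans (sym (freeRun-elim v right j a free (≰⇒> j≰a))) fault-a)
        cover w (left , j , _ , refl , free) with j ≤? b
        ... | yes j≤b = behind j j≤b
        ... | no  j≰b = false≡true-elim (trans (sym (freeRun-elim v left j b free (≰⇒> j≰b))) fault-b)

    afterAhead : Visited
    afterAhead = visitedAlong (initVisited v) pos a

    cost-no-behind : b ≡ 0 → ∀ fuel → run fuel F v (free1 right) v (initVisited v) ≤ a + 0
    cost-no-behind b≡0 = run-straight-≤ a pos right (λ _ → free1 right) (initVisited v) 0 (sweep-right a before-a)
        (λ f → ≤-reflexive (run-covered f (free1 right) (pos a) afterAhead swept))
      where
        swept : covered F v afterAhead ≡ true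
        swept = covered-segment afterAhead (visited-ahead a)
          (λ { zero _ → visited-ahead a 0 z≤n ; (suc j) j<b → ⊥-elim (1+n≰n (≤-trans (subst (suc j ≤_) b≡0 j<b) z≤n)) })

    back-free : ∀ x → x < a → faultyPort F (pos (suc x)) left ≡ false
    back-free x x<a = trans (port-backward F x) (trans (sym (port-forward F x)) (before-a x x<a))

    return-nodes : ℕ → Fin n
    return-nodes i = pos (a ∸ i)

    return-modes : ℕ → Mode
    return-modes zero    = free1 right
    return-modes (suc i) = free2 left

    returning : Straight a return-nodes left return-modes
    returning i i<a = moved , next-return i i<a
      where
        moved : return-nodes (suc i) ≡ move (return-nodes i) left
        moved rewrite ∸-suc a i i<a = sym (node-back right (a ∸ suc i))
        next-return : ∀ i → i < a → next F (return-modes i) (return-nodes i) ≡ just (left , return-modes (suc i))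
        next-return zero    i<a rewrite fault-a | ∸-suc a 0 i<a | back-free (a ∸ 1) (≤-reflexive (sym (∸-suc a 0 i<a))) = refl
        next-return (suc i) i<a rewrite ∸-suc a (suc i) i<a
          | back-free (a ∸ suc (suc i)) (≤-trans (≤-reflexive (sym (∸-suc a (suc i) i<a))) (m∸n≤m a (suc i))) = refl

    behind-nodes : ℕ → Fin n
    behind-nodes zero    = return-nodes a
    behind-nodes (suc i) = node left (suc i)

    behind-modes : ℕ → Mode
    behind-modes zero    = return-modes a
    behind-modes (suc i) = free2 left

    -- at v, coming back (or bouncing there if a = 0), the agent moves left
    leaves-v : 0 < b → ∀ x → x ≡ a → next F (return-modes x) v ≡ just (left , free2 left)
    leaves-v 0<b zero    x≡a rewrite subst (λ y → FaultAhead y ≡ true) (sym x≡a) fault-a | before-b 0 0<b = refl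
    leaves-v 0<b (suc x) _   rewrite before-b 0 0<b = refl

    going-behind : 0 < b → Straight b behind-nodes left behind-modes
    going-behind 0<b zero _ = moved , next-leave
      where
        moved : behind-nodes 1 ≡ move (behind-nodes 0) left
        moved rewrite n∸n≡0 a = refl
        next-leave : next F (behind-modes 0) (behind-nodes 0) ≡ just (left , behind-modes 1)
        next-leave rewrite n∸n≡0 a = leaves-v 0<b a refl
    going-behind 0<b (suc i) i<b = node-suc left (suc i) , next-behind
      where
        next-behind : next F (free2 left) (node left (suc i)) ≡ just (left , free2 left)
        next-behind rewrite before-b (suc i) i<b = refl

    afterReturn : Visited
    afterReturn = visitedAlong afterAhead return-nodes a

    afterBehind : Visited
    afterBehind = visitedAlong afterReturn behind-nodes b

    cost-behind : 0 < b → ∀ fuel → run fuel F v (free1 right) v (initVisited v) ≤ a + (a + (b + 0))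
    cost-behind 0<b = run-straight-≤ a pos right (λ _ → free1 right) (initVisited v) (a + (b + 0)) (sweep-right a before-a)
        (run-straight-≤ a return-nodes left return-modes afterAhead (b + 0) returning
          (run-straight-≤ b behind-nodes left behind-modes afterReturn 0 (going-behind 0<b)
            (λ f → ≤-reflexive (run-covered f (behind-modes b) (behind-nodes b) afterBehind swept))))
      where
        kept : ∀ w → afterAhead w ≡ true → afterBehind w ≡ true
        kept w e = along-keep afterReturn behind-nodes b w (along-keep afterAhead return-nodes a w e)
        behind-visited : ∀ j → j ≤ b → afterBehind (node left j) ≡ true
        behind-visited zero    _   = kept v (visited-ahead a 0 z≤n)
        behind-visited (suc j) j<b = along-visits afterReturn behind-nodes b (suc j) (s≤s z≤n) j<b
        swept : covered F v afterBehind ≡ true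
        swept = covered-segment afterBehind (λ j j≤a → kept (pos j) (visited-ahead a j j≤a)) behind-visited

    module CoveringWalk (t c : ℕ) (summary : Summary (suc c * n) t) where
      open Summary summary

      S start : ℕ
      S = suc c * n
      start = S ∸ b

      start+b : start + b ≡ S
      start+b = m∸n+n≡m (≤-trans (<⇒≤ b<n) (m≤m+n n (c * n)))

      S+a≤start+m : S + a ≤ start + m
      S+a≤start+m = ≤-trans (≤-reflexive (trans (cong (_+ a) (sym start+b)) (+-assoc start b a)))
        (+-monoʳ-≤ start (≤-trans (≤-reflexive (+-comm b a)) a+b≤m))

      behind-end : node left b ≡ pos start
      behind-end = node-opp b start (trans (cong pos start+b) (pos-multiple-v (suc c)))

      ahead-end : pos (S + a) ≡ pos a
      ahead-end = pos-multiple (suc c) a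

      hi≤S+a : hi ≤ S + a
      hi≤S+a with hi ≤? S + a
      ... | yes ok = ok
      ... | no  hi≰ = false≡true-elim (trans (sym crossed-free) fault-a)
        where
          crossed-free : FaultAhead a ≡ false
          crossed-free = trans (cong (λ u → faultyPort F u right) (sym ahead-end)) (free (S + a) (≤-trans lo≤S (m≤m+n S a)) (≰⇒> hi≰))

      start≤lo : start ≤ lo
      start≤lo with start ≤? lo
      ... | yes ok = ok
      ... | no  start≰ with m≤n⇒∃[o]m+o≡n (≰⇒> start≰)
      ...   | k , lo+1+k≡start = false≡true-elim (trans (sym crossed-free) (trans (sym (cong (λ u → faultyPort F u left) behind-end)) fault-b))
        where
          crossed-free : faultyPort F (pos start) left ≡ false
          crossed-free = subst (λ x → faultyPort F (pos x) left ≡ false) lo+1+k≡start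
            (trans (port-backward F (lo + k)) (trans (sym (port-forward F (lo + k)))
              (free (lo + k) (m≤m+n lo k) (≤-trans (≤-reflexive lo+1+k≡start) (≤-trans (m∸n≤m S b) S≤hi)))))

      S+a≤hi : S + a ≤ hi
      S+a≤hi with covers (pos (S + a)) (subst (λ u → inC F v u ≡ true) (sym ahead-end) (inC-ahead a a<n before-a))
      ... | q , lo≤q , q≤hi , eq = subst (_≤ hi)
            (pos-window start q (S + a) (≤-trans start≤lo lo≤q) (≤-trans q≤hi hi≤S+a) S+a≤start+m eq) q≤hi

      lo+b≤S : lo + b ≤ S
      lo+b≤S with covers (node left b) (inC-behind b b<n before-b)
      ... | q , lo≤q , q≤hi , eq = subst (_≤ S) (cong (_+ b) (sym lo≡start)) (≤-reflexive start+b)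
        where
          start≡q : start ≡ q
          start≡q = pos-window start start q ≤-refl (≤-trans start≤lo lo≤q)
            (≤-trans q≤hi (≤-trans hi≤S+a S+a≤start+m)) (sym (trans eq behind-end))
          lo≡start : lo ≡ start
          lo≡start = ≤-antisym (subst (lo ≤_) (sym start≡q) lo≤q) start≤lo

    walk-≥ : ∀ ds → walkCovers F v v (initVisited v) ds ≡ true → (a + twice b ≤ length ds) ⊎ (twice a + b ≤ length ds)
    walk-≥ ds wc with covering-walk ds wc
    ... | c , summary = two-sided-cost (suc c * n) (length ds) lo hi a b paid lo+b≤S S+a≤hi
      where
        open Summary summary
        open CoveringWalk (length ds) c summary

    opt-≥ : ∀ k → k ≤ a + twice b → k ≤ twice a + b → k ≤ opt F v
    opt-≥ k k≤a+2b k≤2a+b = ≤-opt k (≤-trans k≤a+2b a+2b≤2n) λ ds wc → [ ≤-trans k≤a+2b , ≤-trans k≤2a+b ]′ (walk-≥ ds wc)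
      where
        a+2b≤2n : a + twice b ≤ 2 * n
        a+2b≤2n = ≤-trans (+-monoˡ-≤ (twice b) (m≤m+n a a)) (≤-trans (≤-reflexive (regroup a b))
          (≤-trans (+-mono-≤ a+b≤m a+b≤m) (≤-trans (+-mono-≤ (n≤1+n m) (n≤1+n m)) (≤-reflexive (cong (n +_) (sym (+-identityʳ n)))))))
          where
            regroup : ∀ a b → (a + a) + (b + b) ≡ (a + b) + (a + b)
            regroup = solve-∀

module Threshold (m' : ℕ) (v : Fin (suc (suc (suc m')))) where
  m n : ℕ
  m = suc (suc m')
  n = suc m

  2n-3 : ℕ
  2n-3 = 3 + (m' + m')

  T : ℚ
  T = (ℤ.+ 2n-3) / n

  n≤2n-3 : n ≤ 2n-3
  n≤2n-3 = s≤s (s≤s (s≤s (m≤m+n m' m')))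

  ratio-≤-1 : ∀ c o → c ≤ o → ratio c o ≤ℚ T
  ratio-≤-1 c zero    _   = fraction-≤ 1 0 2n-3 m (≤-trans (≤-reflexive (*-identityˡ n)) (≤-trans n≤2n-3 (≤-reflexive (sym (*-identityʳ 2n-3)))))
  ratio-≤-1 c (suc o) c≤o = fraction-≤ c o 2n-3 m (≤-trans (*-mono-≤ c≤o n≤2n-3) (≤-reflexive (*-comm (suc o) 2n-3)))

  ratio-two-sided : ∀ c o a b → c ≤ twice a + b → a + twice b ≤ o → 1 ≤ b → a + b ≤ m → ratio c o ≤ℚ T
  ratio-two-sided c zero    a (suc b) _ a+2b≤0 _ _ = ⊥-elim (1+n≰n (≤-trans (≤-trans (s≤s z≤n) (m≤n+m (suc b + suc b) a)) a+2b≤0))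
  ratio-two-sided c (suc o) a b c≤ a+2b≤o 1≤b a+b≤m = fraction-≤ c o 2n-3 m
      (≤-trans (*-monoˡ-≤ n c≤) (≤-trans cross (*-monoʳ-≤ 2n-3 a+2b≤o)))
    where
      identity : ∀ m' a b → (3 + (m' + m')) * (a + (b + b)) + 3 * a ≡ ((a + a) + b) * suc (suc (suc m')) + 3 * (b * (m' + 1))
      identity = solve-∀
      a≤m'+1 : a ≤ m' + 1
      a≤m'+1 = ≤-pred (≤-trans (≤-trans (≤-reflexive (+-comm 1 a)) (+-monoʳ-≤ a 1≤b)) (≤-trans a+b≤m (≤-reflexive (cong suc (+-comm 1 m')))))
      a≤b·m'+1 : a ≤ b * (m' + 1)
      a≤b·m'+1 = ≤-trans a≤m'+1 (≤-trans (≤-reflexive (sym (*-identityˡ (m' + 1)))) (*-monoˡ-≤ (m' + 1) 1≤b))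
      -- cross-multiplied, the claim reduces to a ≤ b (n - 2), as a ≤ n - 2 and b ≥ 1
      cross : (twice a + b) * n ≤ 2n-3 * (a + twice b)
      cross = +-cancelʳ-≤ (3 * a) _ _ (≤-trans (+-monoʳ-≤ ((twice a + b) * n) (*-monoʳ-≤ 3 a≤b·m'+1)) (≤-reflexive (sym (identity m' a b))))

  T-≤-ratio : ∀ c o X O → X ≤ c → 1 ≤ o → o ≤ O → 2n-3 * O ≤ X * n → T ≤ℚ ratio c o
  T-≤-ratio c (suc o) X O X≤c _ o≤O cross = fraction-≤ 2n-3 m c o (≤-trans (*-monoʳ-≤ 2n-3 o≤O) (≤-trans cross (*-monoˡ-≤ n X≤c)))

  ratio-of : Alg → Faults n → ℚ
  ratio-of A F = ratio (cost A F v) (opt F v)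

  A₀ : Alg
  A₀ = alg right []

  ratio-A₀ : Faults n → ℚ
  ratio-A₀ = ratio-of A₀

  ratio-A₀-faults : ∀ F → RightSweep.FirstFaults m v F → ratio-A₀ F ≤ℚ T
  ratio-A₀-faults F ff = by-size b refl
    where
      open RightSweep m v F
      open FirstFaults ff
      open WithFaults ff
      paid : ∀ a b → a + (a + (b + 0)) ≡ (a + a) + b
      paid = solve-∀
      by-size : ∀ b' → b ≡ b' → ratio-A₀ F ≤ℚ T
      by-size zero b≡0 = ratio-≤-1 _ _ (≤-trans (cost-no-behind b≡0 _)
        (≤-trans (≤-reflexive (+-identityʳ a)) (opt-≥ a (m≤m+n a _) (≤-trans (m≤m+n a a) (m≤m+n _ b)))))
      by-size (suc b') b≡1+b' with a ≤? b
      ... | yes a≤b = ratio-≤-1 _ _ (≤-trans (cost-behind 0<b _)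
            (≤-trans (≤-reflexive (paid a b)) (opt-≥ (twice a + b) 2a+b≤a+2b ≤-refl)))
        where
          0<b : 0 < b
          0<b = subst (0 <_) (sym b≡1+b') (s≤s z≤n)
          2a+b≤a+2b : twice a + b ≤ a + twice b
          2a+b≤a+2b = ≤-trans (≤-reflexive (+-assoc a a b)) (+-monoʳ-≤ a (+-monoˡ-≤ b a≤b))
      ... | no  a≰b = ratio-two-sided _ _ a b (≤-trans (cost-behind 0<b _) (≤-reflexive (paid a b)))
            (opt-≥ (a + twice b) ≤-refl a+2b≤2a+b) 0<b a+b≤m
        where
          0<b : 0 < b
          0<b = subst (0 <_) (sym b≡1+b') (s≤s z≤n)
          a+2b≤2a+b : a + twice b ≤ twice a + b
          a+2b≤2a+b = ≤-trans (≤-reflexive (sym (+-assoc a b b)))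
            (+-monoˡ-≤ b (+-monoʳ-≤ a (<⇒≤ (≰⇒> a≰b))))

  ratio-A₀-≤ : ∀ F → ratio-A₀ F ≤ℚ T
  ratio-A₀-≤ F with RightSweep.fault-shape m v F
  ... | inj₁ none = ratio-≤-1 _ _ (≤-trans (cost-≤ _) (≤-trans (≤-reflexive (+-identityʳ m)) opt-≥))
    where open RightSweep.NoFaultAhead m v F none
  ... | inj₂ ff = ratio-A₀-faults F ff

  overhead-A₀ : overhead v A₀ ≤ℚ T
  overhead-A₀ = max-≤ ratio-A₀ T (allFaults n) ratio-A₀-≤ (fraction-≤ 0 0 2n-3 m z≤n)

  T-≤-overhead : ∀ d z₁ z₂ rest → 1 ≤ z₁ → 1 ≤ z₂ → T ≤ℚ overhead v (alg d (z₁ ∷ z₂ ∷ rest))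
  T-≤-overhead d (suc y₁) (suc y₂) rest _ _ with suc y₁ ≤? m'
  ... | yes short = Q.≤-trans
        (T-≤-ratio _ _ (z₁ + (z₁ + suc z₁)) (suc z₁) (cost-≥ (length (z₁ ∷ z₂ ∷ rest))) opt-≥1 opt-≤-far
          (≤-trans (m≤m+n _ _) (≤-reflexive (sym (cross m' y₁)))))
        (≤-max (ratio-of (alg d (z₁ ∷ z₂ ∷ rest))) (allFaults n) (allFaults-complete n faults))
    where
      open ShortFirstLeg m' v d y₁ y₂ rest short
      cross : ∀ m' y₁ → (suc y₁ + (suc y₁ + suc (suc y₁))) * suc (suc (suc m')) ≡
                      (3 + (m' + m')) * suc (suc y₁) + (y₁ * m' + 6 * y₁ + 6)
      cross = solve-∀
  ... | no  not-short = Q.≤-trans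
        (T-≤-ratio _ _ (M + (M + 1)) n (cost-≥ (length (suc y₁ ∷ suc y₂ ∷ rest))) opt-≥1 opt-≤-n
          (≤-reflexive (cross m')))
        (≤-max (ratio-of (alg d (suc y₁ ∷ suc y₂ ∷ rest))) (allFaults n) (allFaults-complete n faults))
    where
      open LongFirstLeg m' v d (suc y₁) y₂ rest (≰⇒> not-short)
      cross : ∀ m' → (3 + (m' + m')) * suc (suc (suc m')) ≡ (suc m' + (suc m' + 1)) * suc (suc (suc m'))
      cross = solve-∀

lemma2p3 : (n : ℕ) → 3 ≤ n → (v : Fin n) → (k : ℕ) → 2 ≤ k →
    (A : Alg) → InClass k A →
    Σ Alg (λ B → (InClass 0 B ⊎ Σ ℕ (λ i → i ≤ 2 × IsStepAlg i B)) ×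
    overhead v B ≤ℚ overhead v A)
lemma2p3 (suc (suc (suc m'))) _ v k 2≤k (alg d zs) (length≡k , positive , _) =
  A₀ , inj₁ (refl , [] , tt) , Q.≤-trans overhead-A₀ (T-≤-overhead-of zs length≡k positive)
  where
    open Threshold m' v
    T-≤-overhead-of : ∀ zs → length zs ≡ k → All (λ z → 1 ≤ z) zs → T ≤ℚ overhead v (alg d zs)
    T-≤-overhead-of []               refl _ = ⊥-elim (n≮0 2≤k)
    T-≤-overhead-of (_ ∷ [])         refl _ = ⊥-elim (<-irrefl refl 2≤k)
    T-≤-overhead-of (z₁ ∷ z₂ ∷ rest) _    (1≤z₁ ∷ 1≤z₂ ∷ _) = T-≤-overhead d z₁ z₂ rest 1≤z₁ 1≤z₂
lemma2p3 (suc zero)       (s≤s ())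
lemma2p3 (suc (suc zero)) (s≤s (s≤s ()))
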